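{- Let $k>2$ be an integer and let $\Gamma=\{G;G_0,G_1,\ldots,G_{k-1}\}$ be any graph in the family $M_{0,1,\ldots,k-1}$ described in the context. Then $\Gamma$ has a Fulkerson-cover, i.e. there exist six perfect matchings of $\Gamma$ such that every edge of $\Gamma$ belongs to exactly two of them.
   Context: All graphs are finite and simple. A Fulkerson-cover of a cubic graph is a collection of six perfect matchings such that each edge lies in exactly two of them. A cubic graph is cyclically $4$-edge-connected if at least $4$ edges must be removed to disconnect it into two components each containing a circuit. The family $M_{0,1,\ldots,k-1}$ ($k\ge 2$). Let $G_0,\ldots,G_{k-1}$ be cyclically $4$-edge-connected bridgeless cubic graphs, each having a Fulkerson-cover. In each $G_i$ choose an edge $x_iy_i$; let $x_i^0,x_i^1$ be the two neighbours of $x_i$ other than $y_i$, and $y_i^0,y_i^1$ the two neighbours of $y_i$ other than $x_i$. Let $H_i=G_i\setminus\{x_i,y_i\}$. For $k=2$, $\{G;G_0,G_1\}$ is obtained from the disjoint union of $H_0,H_1$ by adding vertices $a_0,b_0,c_0,a_1,b_1,c_1$ and the 13 edges $a_0y_0^0, a_0x_1^0, a_0c_0, c_0b_0, b_0y_0^1, b_0x_1^1, b_1x_0^1, b_1y_1^1, b_1c_1, c_1a_1, a_1x_0^0, a_1y_1^0, c_0c_1$. For $3\le i\le k$, $\{G;G_0,\ldots,G_{i-1}\}$ is obtained from $\{G;G_0,\ldots,G_{i-2}\}$ as follows: add a copy of $H_{i-1}$ and new vertices $a_{i-1},b_{i-1},c_{i-1}$; subdivide by a new vertex $v_{i-3}$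 the unique edge $e_0$ incident with $c_0$ that is not in any $H_j$ and is not one of $a_jc_j,c_jb_j$; delete the edges $a_{i-2}x_0^0$ and $b_{i-2}x_0^1$ and add the edges $a_{i-2}x_{i-1}^0$, $b_{i-2}x_{i-1}^1$, $a_{i-1}x_0^0$, $a_{i-1}y_{i-1}^0$, $b_{i-1}x_0^1$, $b_{i-1}y_{i-1}^1$, $c_{i-1}a_{i-1}$, $c_{i-1}b_{i-1}$, $c_{i-1}v_{i-3}$; all other edges remain the same. Equivalently, $\{G;G_0,\ldots,G_{k-1}\}$ consists of $H_0,\ldots,H_{k-1}$, vertices $a_i,b_i,c_i$ ($0\le i\le k-1$) and $v_0,\ldots,v_{k-3}$, with edges $a_ic_i$, $b_ic_i$, $a_iy_i^0$, $a_ix_{i+1}^0$, $b_iy_i^1$, $b_ix_{i+1}^1$ (indices mod $k$), the path $c_0v_{k-3}v_{k-4}\cdots v_0c_1$ (the single edge $c_0c_1$ if $k=2$), and the edges $c_iv_{i-2}$ for $2\le i\le k-1$. The family of all graphs so obtained (over all choices of the $G_i$ and edges $x_iy_i$) is $M_{0,1,\ldots,k-1}$. -}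

module Defs where

open import Data.Nat using (ℕ; zero; suc; _+_; _∸_; _≤_; _<_)
open import Data.Fin using (Fin; toℕ) renaming (zero to fzero; suc to fsuc)
open import Data.Bool using (Bool; true; false; if_then_else_; not)
open import Data.Product using (Σ; _×_; _,_)
open import Data.Sum using (_⊎_)
open import Relation.Nullary using (¬_)
open import Relation.Binary.PropositionalEquality using (_≡_; _≢_; refl; trans; sym)
open import Relation.Binary.Construct.Closure.ReflexiveTransitive using (Star)
open import Function.Definitions using (Injective)

count : ∀ {m} → (Fin m → Bool) → ℕ
count {zero}  f = 0
count {suc m} f = (if f fzero then 1 else 0) + count (λ i → f (fsuc i))

sumFin : ∀ {m} → (Fin m → ℕ) → ℕ
sumFin {zero}  f = 0
sumFin {suc m} f = f fzero + sumFin (λ i → f (fsuc i))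

Next : ∀ {m} → Fin m → Fin m → Set
Next {m} i j = (suc (toℕ i) ≡ toℕ j) ⊎ ((suc (toℕ i) ≡ m) × (toℕ j ≡ 0))

record Graph : Set₁ where
  field
    V   : Set
    Adj : V → V → Set

record PerfectMatching (G : Graph) (M : Graph.V G → Graph.V G → Bool) : Set where
  open Graph G
  field
    sym-M    : ∀ u v → M u v ≡ M v u
    edges-M  : ∀ u v → M u v ≡ true → Adj u v
    partner  : ∀ v → Σ V (λ u → (M v u ≡ true) × (∀ w → M v w ≡ true → w ≡ u))

HasFulkersonCover : Graph → Set
HasFulkersonCover G =
  Σ (Fin 6 → Graph.V G → Graph.V G → Bool) λ M →
    (∀ i → PerfectMatching G (M i)) ×
    (∀ u v → Graph.Adj G u v → count (λ i → M i u v) ≡ 2)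

record SGraph : Set where
  field
    n      : ℕ
    adj    : Fin n → Fin n → Bool
    adj-sym   : ∀ u v → adj u v ≡ adj v u
    adj-irrefl : ∀ v → adj v v ≡ false

toGraph : SGraph → Graph
toGraph G = record { V = Fin (SGraph.n G) ; Adj = λ u v → SGraph.adj G u v ≡ true }

module _ (G : SGraph) where
  open SGraph G

  degree : Fin n → ℕ
  degree v = count (adj v)

  Cubic : Set
  Cubic = ∀ v → degree v ≡ 3

  ConnectedWithout : Fin n → Fin n → Set
  ConnectedWithout u v =
    Star (λ a b → (adj a b ≡ true) × ¬ (((a ≡ u) × (b ≡ v)) ⊎ ((a ≡ v) × (b ≡ u)))) u v

  Bridgeless : Set
  Bridgeless = ∀ u v → adj u v ≡ true → ConnectedWithout u v

  HasCircuitIn : (Fin n → Bool) → Set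
  HasCircuitIn S =
    Σ ℕ λ m → (3 ≤ m) × Σ (Fin m → Fin n) λ f →
      Injective _≡_ _≡_ f × (∀ i → S (f i) ≡ true) ×
      (∀ i j → Next i j → adj (f i) (f j) ≡ true)

  cutSize : (Fin n → Bool) → ℕ
  cutSize S = sumFin (λ u → if S u then count (λ v → if S v then false else adj u v) else 0)

  Cyclically4EdgeConnected : Set
  Cyclically4EdgeConnected =
    ∀ S → HasCircuitIn S → HasCircuitIn (λ v → not (S v)) → 4 ≤ cutSize S

-- The data of one building block G_i with the chosen edge x y and
-- the labelled neighbours x⁰ x¹ (of x) and y⁰ y¹ (of y)

record Piece : Set where
  field
    G : SGraph
  open SGraph G public
  field
    x y x0 x1 y0 y1 : Fin n
    xy  : adj x y ≡ true
    xx0 : adj x x0 ≡ true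
    xx1 : adj x x1 ≡ true
    yy0 : adj y y0 ≡ true
    yy1 : adj y y1 ≡ true
    x0≢x1 : x0 ≢ x1
    x0≢y  : x0 ≢ y
    x1≢y  : x1 ≢ y
    y0≢y1 : y0 ≢ y1
    y0≢x  : y0 ≢ x
    y1≢x  : y1 ≢ x

  private
    nbr≢ : ∀ {a b} → adj a b ≡ true → b ≢ a
    nbr≢ {a} e refl with trans (sym e) (adj-irrefl a)
    ... | ()

  x0≢x : x0 ≢ x
  x0≢x = nbr≢ xx0
  x1≢x : x1 ≢ x
  x1≢x = nbr≢ xx1
  y0≢y : y0 ≢ y
  y0≢y = nbr≢ yy0
  y1≢y : y1 ≢ y
  y1≢y = nbr≢ yy1

-- The graph {G; G_0, ..., G_{k-1}} of the family M_{0,1,...,k-1}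
-- (explicit description), for k ≥ 3.

module Construction (k : ℕ) (P : Fin k → Piece) where
  open Piece

  data ΓV : Set where
    -- vertices of H_i = G_i - {x_i, y_i}
    hv : (i : Fin k) (v : Fin (n (P i))) → .(v ≢ x (P i)) → .(v ≢ y (P i)) → ΓV
    aV bV cV : Fin k → ΓV
    vV : Fin (k ∸ 2) → ΓV

  data Arc : ΓV → ΓV → Set where
    hh : (i : Fin k) (u w : Fin (n (P i)))
         .(pu : u ≢ x (P i)) .(qu : u ≢ y (P i))
         .(pw : w ≢ x (P i)) .(qw : w ≢ y (P i)) →
         adj (P i) u w ≡ true → Arc (hv i u pu qu) (hv i w pw qw)
    ac : ∀ i → Arc (aV i) (cV i)
    bc : ∀ i → Arc (bV i) (cV i)
    ay : ∀ i → Arc (aV i) (hv i (y0 (P i)) (y0≢x (P i)) (y0≢y (P i)))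
    by : ∀ i → Arc (bV i) (hv i (y1 (P i)) (y1≢x (P i)) (y1≢y (P i)))
    ax : ∀ i j → Next i j → Arc (aV i) (hv j (x0 (P j)) (x0≢x (P j)) (x0≢y (P j)))
    bx : ∀ i j → Next i j → Arc (bV i) (hv j (x1 (P j)) (x1≢x (P j)) (x1≢y (P j)))
    -- the path c_0 v_{k-3} v_{k-4} ... v_0 c_1
    c0v : ∀ i j → toℕ i ≡ 0 → suc (toℕ j) ≡ k ∸ 2 → Arc (cV i) (vV j)
    vv  : ∀ j j' → toℕ j' ≡ suc (toℕ j) → Arc (vV j') (vV j)
    vc1 : ∀ j i → toℕ j ≡ 0 → toℕ i ≡ 1 → Arc (vV j) (cV i)
    cv  : ∀ i j → toℕ i ≡ 2 + toℕ j → Arc (cV i) (vV j)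

  ΓAdj : ΓV → ΓV → Set
  ΓAdj u v = Arc u v ⊎ Arc v u

  Γ : Graph
  Γ = record { V = ΓV ; Adj = ΓAdj }

-- Every piece G_i carries a Fulkerson cover M_i^0, …, M_i^5.  On the edges at the chosen
-- edge x_i y_i a perfect matching of G_i either contains x_i y_i, or it matches x_i with one
-- of x_i^0, x_i^1 and y_i with one of y_i^0, y_i^1.  Since every edge at x_i and y_i lies in
-- exactly two of the six matchings, they can be listed in six slots grouped into three colour
-- classes of two slots each, so that one class holds the two matchings through x_i y_i and
-- each of the other classes holds two matchings using complementary edges at x_i and at y_i.
--
-- The vertices c_i and v_m span a cubic tree whose edges are properly 3-coloured, the leaf c_i
-- receiving some colour w_i.  Choose the class z_i of piece i carrying x_i y_i so that z_i,
-- z_{i+1}, w_i are distinct.  In a slot of colour z_i or z_{i+1} one of the pieces i, i+1 uses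
-- its edge x y; in the two slots of colour w_i exchanging them in piece i+1 if necessary
-- ensures that y_i^s and x_{i+1}^s never both need a_i (s = 0) or b_i (s = 1).  These
-- exchanges propagate around the cycle of pieces, and the propagation is consistent because at
-- piece 0 the class shared with the previous piece differs from the class shared with the next.
--
-- The matching of Γ in slot j is then the union of the slot-j matchings of the H_i, the edges
-- from a_i, b_i to whichever neighbour needs them (or else to c_i), and the edges of the tree
-- whose colour is the class of j.  An edge of H_i lies in two matchings because it does in
-- G_i, an edge at a_i or b_i because the corresponding edge of G_i does, and a tree edge
-- because its colour class has two slots.
module Submission where

open import Defs
open import Data.Nat as ℕ using (ℕ; zero; suc; _+_; _<_; s≤s; _≤ᵇ_)
open import Data.Nat.Properties
  using (+-0-commutativeMonoid; +-suc; +-cancelˡ-≡; suc-injective; <-irrefl; 1+n≢n; 0≢1+n; m≢1+n+m)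
open import Data.Bool as Bool using (Bool; true; false; not; _∧_; _∨_; _xor_; if_then_else_)
open import Data.Bool.Properties using (∧-identityʳ; ∧-zeroʳ; not-distribˡ-xor; xor-same; xor-assoc)
open import Data.Fin as Fin using (Fin; toℕ; fromℕ; inject₁)
open import Data.Fin.Patterns using (0F; 1F; 2F; 3F; 4F; 5F)
open import Data.Fin.Properties using (toℕ-injective; toℕ<n; toℕ-fromℕ) renaming (0≢1+n to 0F≢1+n)
open import Data.Fin.Permutation using (Permutation′; permutation; _⟨$⟩ʳ_; _∘ₚ_; transpose) renaming (id to idₚ)
open import Data.List using (allFin; findᵇ)
open import Data.Maybe using (fromMaybe)
open import Data.Product using (Σ; _×_; _,_; proj₁; proj₂)
open import Data.Sum using (_⊎_; inj₁; inj₂; [_,_]′; swap)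
open import Data.Empty using (⊥-elim; ⊥-elim-irr)
open import Function using (case_of_)
open import Function.Bundles using (mk⇔)
open import Relation.Nullary using (Dec; yes; no; does)
open import Relation.Nullary.Decidable using (map′; _×-dec_; dec-true; dec-false; does-⇔)
open import Relation.Binary.Definitions using (DecidableEquality)
open import Relation.Binary.PropositionalEquality
  using (_≡_; _≢_; refl; sym; trans; cong; cong₂; subst; subst₂; ≢-sym; module ≡-Reasoning)
open import Algebra.Properties.CommutativeMonoid.Sum +-0-commutativeMonoid using (sum; sum-permute)
open ≡-Reasoning

does-sound : ∀ {A : Set} (d : Dec A) → does d ≡ true → A
does-sound (yes a) _ = a

does-≡ : ∀ {A : Set} (d : Dec A) b → (A → b ≡ true) → (b ≡ true → A) → does d ≡ b
does-≡ (yes a)  b     to _    = sym (to a)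
does-≡ (no _)   false _  _    = refl
does-≡ (no ¬a)  true  _  from = ⊥-elim (¬a (from refl))

indicator : Bool → ℕ
indicator b = if b then 1 else 0

count-cong : ∀ {m} {f g : Fin m → Bool} → (∀ i → f i ≡ g i) → count f ≡ count g
count-cong {zero}  _   = refl
count-cong {suc m} f≗g = cong₂ _+_ (cong indicator (f≗g Fin.zero)) (count-cong (λ i → f≗g (Fin.suc i)))

count≡sum : ∀ {m} (f : Fin m → Bool) → count f ≡ sum (λ i → indicator (f i))
count≡sum {zero}  f = refl
count≡sum {suc m} f = cong (indicator (f Fin.zero) +_) (count≡sum (λ i → f (Fin.suc i)))

count-permute : ∀ {m} (f : Fin m → Bool) (σ : Permutation′ m) → count (λ i → f (σ ⟨$⟩ʳ i)) ≡ count f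
count-permute f σ = begin
  count (λ i → f (σ ⟨$⟩ʳ i))           ≡⟨ count≡sum (λ i → f (σ ⟨$⟩ʳ i)) ⟩
  sum (λ i → indicator (f (σ ⟨$⟩ʳ i))) ≡⟨ sum-permute (λ i → indicator (f i)) σ ⟨
  sum (λ i → indicator (f i))          ≡⟨ count≡sum f ⟨
  count f                              ∎

count-partition : ∀ {m} (f g : Fin m → Bool) → (∀ i → f i ∧ g i ≡ false) →
                  count f + count g + count (λ i → not (f i) ∧ not (g i)) ≡ m
count-partition {zero} f g _ = refl
count-partition {suc m} f g disjoint
  with f Fin.zero | g Fin.zero | disjoint Fin.zero
     | count-partition (λ i → f (Fin.suc i)) (λ i → g (Fin.suc i)) (λ i → disjoint (Fin.suc i))
... | true  | false | _ | ih = cong suc ih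
... | false | true  | _ | ih =
  trans (cong (_+ count (λ i → not (f (Fin.suc i)) ∧ not (g (Fin.suc i))))
              (+-suc (count (λ i → f (Fin.suc i))) (count (λ i → g (Fin.suc i)))))
        (cong suc ih)
... | false | false | _ | ih = trans (+-suc _ _) (cong suc ih)

_∖_ : ∀ {m} → (Fin m → Bool) → Fin m → Fin m → Bool
(f ∖ a) i = f i ∧ not (does (i Fin.≟ a))

∖-keeps : ∀ {m} (f : Fin m → Bool) {a w} → w ≢ a → f w ≡ true → (f ∖ a) w ≡ true
∖-keeps f {a} {w} w≢a fw with w Fin.≟ a
... | yes w≡a = ⊥-elim (w≢a w≡a)
... | no _    = trans (∧-identityʳ (f w)) fw

count-∖ : ∀ {m} (f : Fin m → Bool) {a} → f a ≡ true → count f ≡ suc (count (f ∖ a))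
count-∖ {suc m} f {Fin.zero} fa rewrite fa =
  cong suc (count-cong (λ i → sym (∧-identityʳ (f (Fin.suc i)))))
count-∖ {suc m} f {Fin.suc a} fa rewrite ∧-identityʳ (f Fin.zero) with f Fin.zero
... | true  = cong suc (count-∖ (λ i → f (Fin.suc i)) fa)
... | false = count-∖ (λ i → f (Fin.suc i)) fa

count≡3-exhausted : ∀ {m} (f : Fin m → Bool) → count f ≡ 3 →
  ∀ {a b c} → f a ≡ true → f b ≡ true → f c ≡ true → a ≢ b → a ≢ c → b ≢ c →
  ∀ w → f w ≡ true → w ≡ a ⊎ w ≡ b ⊎ w ≡ c
count≡3-exhausted f count≡3 {a} {b} {c} fa fb fc a≢b a≢c b≢c w fw
  with w Fin.≟ a | w Fin.≟ b | w Fin.≟ c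
... | yes w≡a | _       | _       = inj₁ w≡a
... | no _    | yes w≡b | _       = inj₂ (inj₁ w≡b)
... | no _    | no _    | yes w≡c = inj₂ (inj₂ w≡c)
... | no w≢a  | no w≢b  | no w≢c  with begin
  3                                         ≡⟨ count≡3 ⟨
  count f                                   ≡⟨ count-∖ f fa ⟩
  suc (count (f ∖ a))                       ≡⟨ cong suc (count-∖ (f ∖ a) fb′) ⟩
  2 + count ((f ∖ a) ∖ b)                   ≡⟨ cong (2 +_) (count-∖ ((f ∖ a) ∖ b) fc′) ⟩
  3 + count (((f ∖ a) ∖ b) ∖ c)             ≡⟨ cong (3 +_) (count-∖ (((f ∖ a) ∖ b) ∖ c) fw′) ⟩
  4 + count ((((f ∖ a) ∖ b) ∖ c) ∖ w)       ∎
  where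
  fb′ = ∖-keeps f (≢-sym a≢b) fb
  fc′ = ∖-keeps (f ∖ a) (≢-sym b≢c) (∖-keeps f (≢-sym a≢c) fc)
  fw′ = ∖-keeps ((f ∖ a) ∖ b) w≢c (∖-keeps (f ∖ a) w≢b (∖-keeps f w≢a fw))
... | ()

-- Perfect matchings from involutions

module _ (G : Graph) (_≟_ : DecidableEquality (Graph.V G)) where
  open Graph G

  matchingOf : (V → V) → V → V → Bool
  matchingOf π u v = does (π u ≟ v)

  involution-perfectMatching : (π : V → V) → (∀ v → π (π v) ≡ v) → (∀ v → Adj v (π v)) →
                               PerfectMatching G (matchingOf π)
  involution-perfectMatching π involutive adjacent = record
    { sym-M   = λ u v → does-⇔ (mk⇔ (flip u v) (flip v u)) (π u ≟ v) (π v ≟ u)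
    ; edges-M = λ u v πu≡v → subst (Adj u) (does-sound (π u ≟ v) πu≡v) (adjacent u)
    ; partner = λ v → π v , dec-true (π v ≟ π v) refl , λ w πv≡w → sym (does-sound (π v ≟ w) πv≡w)
    }
    where
    flip : ∀ u v → π u ≡ v → π v ≡ u
    flip u v πu≡v = trans (cong π (sym πu≡v)) (involutive u)

next : ∀ {n} → Fin (suc n) → Fin (suc n)
next {zero}  Fin.zero    = Fin.zero
next {suc n} Fin.zero    = Fin.suc Fin.zero
next {suc n} (Fin.suc i) = skipZero (next i)
  where
  skipZero : Fin (suc n) → Fin (suc (suc n))
  skipZero Fin.zero    = Fin.zero
  skipZero (Fin.suc j) = Fin.suc (Fin.suc j)

prev : ∀ {n} → Fin (suc n) → Fin (suc n)
prev Fin.zero    = fromℕ _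
prev (Fin.suc i) = inject₁ i

next-fromℕ : ∀ n → next (fromℕ n) ≡ Fin.zero
next-fromℕ zero    = refl
next-fromℕ (suc n) rewrite next-fromℕ n = refl

next-inject₁ : ∀ {n} (i : Fin n) → next (inject₁ i) ≡ Fin.suc i
next-inject₁ {suc n} Fin.zero    = refl
next-inject₁ {suc n} (Fin.suc i) rewrite next-inject₁ i = refl

next-prev : ∀ {n} (i : Fin (suc n)) → next (prev i) ≡ i
next-prev Fin.zero    = next-fromℕ _
next-prev (Fin.suc i) = next-inject₁ i

prev-next : ∀ {n} (i : Fin (suc n)) → prev (next i) ≡ i
prev-next {zero}  Fin.zero = refl
prev-next {suc n} Fin.zero = refl
prev-next {suc n} (Fin.suc i) with next i | prev-next i
... | Fin.zero  | fromℕ≡i  = cong Fin.suc fromℕ≡i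
... | Fin.suc j | inject≡i = cong Fin.suc inject≡i

next≡zero⇒fromℕ : ∀ {n} (i : Fin (suc n)) → next i ≡ Fin.zero → i ≡ fromℕ n
next≡zero⇒fromℕ i wraps = trans (sym (prev-next i)) (cong prev wraps)

Next-next : ∀ {n} (i : Fin (suc n)) → Next i (next i)
Next-next {zero}  Fin.zero = inj₂ (refl , refl)
Next-next {suc n} Fin.zero = inj₁ refl
Next-next {suc n} (Fin.suc i) with next i | Next-next i
... | Fin.zero  | inj₂ (last , _) = inj₂ (cong suc last , refl)
... | Fin.suc j | inj₁ step       = inj₁ (cong suc step)

Next-functional : ∀ {m} {i j j′ : Fin m} → Next i j → Next i j′ → j ≡ j′
Next-functional (inj₁ step) (inj₁ step′) = toℕ-injective (trans (sym step) step′)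
Next-functional (inj₂ (_ , j≡0)) (inj₂ (_ , j′≡0)) = toℕ-injective (trans j≡0 (sym j′≡0))
Next-functional {j = j} (inj₁ step) (inj₂ (last , _)) =
  ⊥-elim (<-irrefl (trans (sym step) last) (toℕ<n j))
Next-functional {j′ = j′} (inj₂ (last , _)) (inj₁ step′) =
  ⊥-elim (<-irrefl (trans (sym step′) last) (toℕ<n j′))

Next⇒next : ∀ {n} {i j : Fin (suc n)} → Next i j → j ≡ next i
Next⇒next {i = i} i→j = Next-functional i→j (Next-next i)

next≢id : ∀ {n} (i : Fin (suc (suc n))) → next i ≢ i
next≢id i next≡i with next i | Next-next i
next≢id i refl | _ | inj₁ step        = 1+n≢n step
next≢id i refl | _ | inj₂ (last , i≡0) with () ← trans (sym last) (cong suc i≡0)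

toℕ-next : ∀ {n} (i : Fin (suc n)) → next i ≢ Fin.zero → toℕ (next i) ≡ suc (toℕ i)
toℕ-next i no-wrap with Next-next i
... | inj₁ step        = sym step
... | inj₂ (_ , wraps) = ⊥-elim (no-wrap (toℕ-injective wraps))

toℕ-prev : ∀ {n} (i : Fin (suc n)) → i ≢ Fin.zero → toℕ i ≡ suc (toℕ (prev i))
toℕ-prev i i≢0 = trans (cong toℕ (sym (next-prev i))) (toℕ-next (prev i) (λ wraps → i≢0 (trans (sym (next-prev i)) wraps)))

walk : ∀ {n} → (Fin (suc n) → Bool → Bool) → Bool → Fin (suc n) → Bool
walk f b Fin.zero            = b
walk {suc n} f b (Fin.suc i) = walk (λ j → f (Fin.suc j)) (f Fin.zero b) i

walk-next : ∀ {n} (f : Fin (suc n) → Bool → Bool) b i → next i ≢ Fin.zero →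
            walk f b (next i) ≡ f i (walk f b i)
walk-next {zero}  f b Fin.zero no-wrap = ⊥-elim (no-wrap refl)
walk-next {suc n} f b Fin.zero _ = refl
walk-next {suc n} f b (Fin.suc i) no-wrap with next i in next-i≡
... | Fin.zero  = ⊥-elim (no-wrap refl)
... | Fin.suc j =
  trans (cong (walk f′ (f Fin.zero b)) (sym next-i≡))
        (walk-next f′ (f Fin.zero b) i (λ next-i≡0 → 0F≢1+n (trans (sym next-i≡0) next-i≡)))
  where f′ = λ j → f (Fin.suc j)

walk-step-irrelevant : ∀ {n} (f : Fin (suc n) → Bool → Bool) → (∀ a b → f Fin.zero a ≡ f Fin.zero b) →
                       ∀ b b′ i → f i (walk f b i) ≡ f i (walk f b′ i)
walk-step-irrelevant f f₀-constant b b′ Fin.zero = f₀-constant b b′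
walk-step-irrelevant {suc n} f f₀-constant b b′ (Fin.suc i) =
  cong (λ c → f (Fin.suc i) (walk (λ j → f (Fin.suc j)) c i)) (f₀-constant b b′)

cyclic-recurrence : ∀ {n} (f : Fin (suc n) → Bool → Bool) → (∀ a b → f Fin.zero a ≡ f Fin.zero b) →
                    Σ (Fin (suc n) → Bool) λ a → ∀ i → a (next i) ≡ f i (a i)
cyclic-recurrence f f₀-constant = a , recurrence
  where
  -- The step from the last index back to 0 holds because f 0 ignores its argument.
  last  = prev Fin.zero
  start = f last (walk f false last)
  a     = walk f start
  recurrence : ∀ i → a (next i) ≡ f i (a i)
  recurrence i with next i Fin.≟ Fin.zero
  ... | no no-wrap = walk-next f start i no-wrap
  ... | yes wraps  = begin
    a (next i)      ≡⟨ cong a wraps ⟩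
    start           ≡⟨ walk-step-irrelevant f f₀-constant false start last ⟩
    f last (a last) ≡⟨ cong (λ j → f j (a j)) (trans (cong prev (sym wraps)) (prev-next i)) ⟩
    f i (a i)       ∎

-- The trace of a perfect matching on the five edges at xy: either it contains xy, or it
-- matches x with x^α and y with y^β, where x^false, x^true stand for x0, x1 (likewise for y).
data Code : Set where
  edge  : Code
  sides : (α β : Bool) → Code

isEdge : Code → Bool
isEdge edge        = true
isEdge (sides _ _) = false

xUses yUses : Bool → Code → Bool
xUses _ edge        = false
xUses s (sides α _) = if s then α else not α
yUses _ edge        = false
yUses s (sides _ β) = if s then β else not β

xSide ySide : Code → Bool
xSide edge        = false
xSide (sides α _) = α
ySide edge        = false
ySide (sides _ β) = β

compl : Code → Code
compl edge        = edge
compl (sides α β) = sides (not α) (not β)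

_≟κ_ : DecidableEquality Code
edge      ≟κ edge        = yes refl
edge      ≟κ sides _ _   = no λ ()
sides _ _ ≟κ edge        = no λ ()
sides α β ≟κ sides α′ β′ with α Bool.≟ α′ | β Bool.≟ β′
... | yes refl | yes refl = yes refl
... | no α≢α′  | _        = no λ { refl → α≢α′ refl }
... | yes _    | no β≢β′  = no λ { refl → β≢β′ refl }

data Colour : Set where
  c₀ c₁ c₂ : Colour

_≟ᶜ_ : DecidableEquality Colour
c₀ ≟ᶜ c₀ = yes refl
c₁ ≟ᶜ c₁ = yes refl
c₂ ≟ᶜ c₂ = yes refl
c₀ ≟ᶜ c₁ = no λ ()
c₀ ≟ᶜ c₂ = no λ ()
c₁ ≟ᶜ c₀ = no λ ()
c₁ ≟ᶜ c₂ = no λ ()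
c₂ ≟ᶜ c₀ = no λ ()
c₂ ≟ᶜ c₁ = no λ ()

slot : Colour → Bool → Fin 6
slot c₀ false = 0F
slot c₀ true  = 1F
slot c₁ false = 2F
slot c₁ true  = 3F
slot c₂ false = 4F
slot c₂ true  = 5F

colour : Fin 6 → Colour
colour 0F = c₀
colour 1F = c₀
colour 2F = c₁
colour 3F = c₁
colour 4F = c₂
colour 5F = c₂

side : Fin 6 → Bool
side 0F = false
side 1F = true
side 2F = false
side 3F = true
side 4F = false
side 5F = true

mate : Fin 6 → Fin 6
mate j = slot (colour j) (not (side j))

colour-slot : ∀ c s → colour (slot c s) ≡ c
colour-slot c₀ false = refl
colour-slot c₀ true  = refl
colour-slot c₁ false = refl
colour-slot c₁ true  = refl
colour-slot c₂ false = refl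
colour-slot c₂ true  = refl

side-slot : ∀ c s → side (slot c s) ≡ s
side-slot c₀ false = refl
side-slot c₀ true  = refl
side-slot c₁ false = refl
side-slot c₁ true  = refl
side-slot c₂ false = refl
side-slot c₂ true  = refl

slot-colour-side : ∀ j → slot (colour j) (side j) ≡ j
slot-colour-side 0F = refl
slot-colour-side 1F = refl
slot-colour-side 2F = refl
slot-colour-side 3F = refl
slot-colour-side 4F = refl
slot-colour-side 5F = refl

mate-slot : ∀ c s → mate (slot c s) ≡ slot c (not s)
mate-slot c s rewrite colour-slot c s | side-slot c s = refl

count-colour : ∀ c → count (λ j → does (colour j ≟ᶜ c)) ≡ 2
count-colour c₀ = refl
count-colour c₁ = refl
count-colour c₂ = refl

record IsLayout (κ : Fin 6 → Code) (e : Colour) (σ : Permutation′ 6) : Set where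
  field
    edge-slots : ∀ j → isEdge (κ (σ ⟨$⟩ʳ j)) ≡ does (colour j ≟ᶜ e)
    paired     : ∀ j → colour j ≢ e → κ (σ ⟨$⟩ʳ mate j) ≡ compl (κ (σ ⟨$⟩ʳ j))

Layout : (Fin 6 → Code) → Colour → Set
Layout κ e = Σ (Permutation′ 6) (IsLayout κ e)

IsLayout-cong : ∀ {κ κ′ e σ} → (∀ j → κ j ≡ κ′ j) → IsLayout κ e σ → IsLayout κ′ e σ
IsLayout-cong {σ = σ} κ≗κ′ L = record
  { edge-slots = λ j → trans (cong isEdge (sym (κ≗κ′ (σ ⟨$⟩ʳ j)))) (edge-slots j)
  ; paired     = λ j j≢e → trans (sym (κ≗κ′ (σ ⟨$⟩ʳ mate j)))
                                  (trans (paired j j≢e) (cong compl (κ≗κ′ (σ ⟨$⟩ʳ j))))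
  }
  where open IsLayout L

module _ {κ e σ} (L : IsLayout κ e σ) where
  open IsLayout L

  not-edge-away : ∀ w s → w ≢ e → isEdge (κ (σ ⟨$⟩ʳ slot w s)) ≡ false
  not-edge-away w s w≢e with colour (slot w s) ≟ᶜ e | edge-slots (slot w s)
  ... | yes w≡e | _        = ⊥-elim (w≢e (trans (sym (colour-slot w s)) w≡e))
  ... | no _    | not-edge = not-edge

  second-slot : ∀ w → w ≢ e → κ (σ ⟨$⟩ʳ slot w true) ≡ compl (κ (σ ⟨$⟩ʳ slot w false))
  second-slot w w≢e =
    trans (cong (λ i → κ (σ ⟨$⟩ʳ i)) (sym (mate-slot w false)))
          (paired (slot w false) (λ w≡e → w≢e (trans (sym (colour-slot w false)) w≡e)))

Admissible : (Fin 6 → Code) → Set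
Admissible κ =
  count (λ j → isEdge (κ j)) ≡ 2 × count (λ j → xUses false (κ j)) ≡ 2 × count (λ j → yUses false (κ j)) ≡ 2

admissible? : ∀ κ → Dec (Admissible κ)
admissible? κ = (count (λ j → isEdge (κ j)) ℕ.≟ 2) ×-dec (count (λ j → xUses false (κ j)) ℕ.≟ 2) ×-dec
                (count (λ j → yUses false (κ j)) ℕ.≟ 2)

placeAt : (Fin 6 → Code) → Fin 6 → (Code → Bool) → Permutation′ 6 → Permutation′ 6
placeAt κ pos p σ = transpose pos found ∘ₚ σ
  where
  found = fromMaybe pos (findᵇ (λ j → (toℕ pos ≤ᵇ toℕ j) ∧ p (κ (σ ⟨$⟩ʳ j))) (allFin 6))

-- Moves edge codes into slots 0 and 1 and the complement of the code in slot 2 into slot 3;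
-- for admissible codes the last two slots then hold a complementary pair as well.
sortCodes : (Fin 6 → Code) → Permutation′ 6
sortCodes κ = placeAt κ (slot c₁ true) (λ c → does (c ≟κ compl (κ (σ ⟨$⟩ʳ slot c₁ false)))) σ
  where
  σ = placeAt κ (slot c₀ true) isEdge (placeAt κ (slot c₀ false) isEdge idₚ)

swapWithClass₀ : Colour → Permutation′ 6
swapWithClass₀ c₀ = idₚ
swapWithClass₀ c  = transpose (slot c₀ false) (slot c false) ∘ₚ transpose (slot c₀ true) (slot c true)

arrange : (Fin 6 → Code) → Colour → Permutation′ 6
arrange κ e = swapWithClass₀ e ∘ₚ sortCodes κ

module LayoutCheck where

  ∧-true : ∀ x {y} → x ∧ y ≡ true → x ≡ true × y ≡ true
  ∧-true true y≡true = refl , y≡true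

  ∨-true : ∀ x {y} → x ∨ y ≡ true → x ≡ true ⊎ y ≡ true
  ∨-true true  _      = inj₁ refl
  ∨-true false y≡true = inj₂ y≡true

  allᵇ : ∀ {m} → (Fin m → Bool) → Bool
  allᵇ {zero}  f = true
  allᵇ {suc m} f = f Fin.zero ∧ allᵇ (λ j → f (Fin.suc j))

  allᵇ-sound : ∀ {m} (f : Fin m → Bool) → allᵇ f ≡ true → ∀ j → f j ≡ true
  allᵇ-sound f all Fin.zero    = proj₁ (∧-true (f Fin.zero) all)
  allᵇ-sound f all (Fin.suc j) = allᵇ-sound (λ j → f (Fin.suc j)) (proj₂ (∧-true (f Fin.zero) all)) j

  every : (Code → Bool) → Bool
  every p = p edge ∧ p (sides false false) ∧ p (sides false true) ∧ p (sides true false) ∧ p (sides true true)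

  every-sound : ∀ p → every p ≡ true → ∀ c → p c ≡ true
  every-sound p all with ∧-true (p edge) all
  ... | t-edge , r₁ with ∧-true (p (sides false false)) r₁
  ... | t₀₀ , r₂ with ∧-true (p (sides false true)) r₂
  ... | t₀₁ , r₃ with ∧-true (p (sides true false)) r₃
  ... | t₁₀ , t₁₁ = λ
    { edge                → t-edge
    ; (sides false false) → t₀₀
    ; (sides false true)  → t₀₁
    ; (sides true false)  → t₁₀
    ; (sides true true)   → t₁₁
    }

  everyColour : (Colour → Bool) → Bool
  everyColour p = p c₀ ∧ p c₁ ∧ p c₂

  everyColour-sound : ∀ p → everyColour p ≡ true → ∀ c → p c ≡ true
  everyColour-sound p all with ∧-true (p c₀) all
  ... | t₀ , r₁ with ∧-true (p c₁) r₁
  ... | t₁ , t₂ = λ { c₀ → t₀ ; c₁ → t₁ ; c₂ → t₂ }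

  slotOKᵇ : (Fin 6 → Code) → Colour → Permutation′ 6 → Fin 6 → Bool
  slotOKᵇ κ e σ j = does (isEdge (κ (σ ⟨$⟩ʳ j)) Bool.≟ does (colour j ≟ᶜ e)) ∧
                    (does (colour j ≟ᶜ e) ∨ does (κ (σ ⟨$⟩ʳ mate j) ≟κ compl (κ (σ ⟨$⟩ʳ j))))

  isLayoutᵇ-sound : ∀ κ e σ → allᵇ (slotOKᵇ κ e σ) ≡ true → IsLayout κ e σ
  isLayoutᵇ-sound κ e σ ok = record
    { edge-slots = λ j → does-sound (isEdge (κ (σ ⟨$⟩ʳ j)) Bool.≟ does (colour j ≟ᶜ e)) (proj₁ (at j))
    ; paired     = λ j j≢e →
        [ (λ j≡e → ⊥-elim (j≢e (does-sound (colour j ≟ᶜ e) j≡e)))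
        , does-sound (κ (σ ⟨$⟩ʳ mate j) ≟κ compl (κ (σ ⟨$⟩ʳ j))) ]′
        (∨-true (does (colour j ≟ᶜ e)) (proj₂ (at j)))
    }
    where
    at = λ j → ∧-true (does (isEdge (κ (σ ⟨$⟩ʳ j)) Bool.≟ does (colour j ≟ᶜ e))) (allᵇ-sound (slotOKᵇ κ e σ) ok j)

  tuple : Code → Code → Code → Code → Code → Code → Fin 6 → Code
  tuple a b c d e f 0F = a
  tuple a b c d e f 1F = b
  tuple a b c d e f 2F = c
  tuple a b c d e f 3F = d
  tuple a b c d e f 4F = e
  tuple a b c d e f 5F = f

  -- Opaque, so that sortsAll is never unfolded at a partially known tuple of codes: the type
  -- checker would then run the sorting procedure symbolically.
  opaque
    sortsAll : (Fin 6 → Code) → Bool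
    sortsAll κ = not (does (admissible? κ)) ∨ everyColour (λ e → allᵇ (slotOKᵇ κ e (arrange κ e)))

    sortsAll-≡ : ∀ κ →
      sortsAll κ ≡ not (does (admissible? κ)) ∨ everyColour (λ e → allᵇ (slotOKᵇ κ e (arrange κ e)))
    sortsAll-≡ κ = refl

  opaque
    unfolding sortsAll
    exhaustive :
      (every λ a → every λ b → every λ c → every λ d → every λ e → every λ f → sortsAll (tuple a b c d e f)) ≡ true
    exhaustive = refl

  sorts : ∀ a b c d e f → sortsAll (tuple a b c d e f) ≡ true
  sorts a b c d e f =
    every-sound (λ f → sortsAll (tuple a b c d e f))
     (every-sound (λ e → every λ f → sortsAll (tuple a b c d e f))
      (every-sound (λ d → every λ e → every λ f → sortsAll (tuple a b c d e f))
       (every-sound (λ c → every λ d → every λ e → every λ f → sortsAll (tuple a b c d e f))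
        (every-sound (λ b → every λ c → every λ d → every λ e → every λ f → sortsAll (tuple a b c d e f))
         (every-sound (λ a → every λ b → every λ c → every λ d → every λ e → every λ f → sortsAll (tuple a b c d e f))
          exhaustive a) b) c) d) e) f

  tabulate₆ : (Fin 6 → Code) → Fin 6 → Code
  tabulate₆ κ = tuple (κ 0F) (κ 1F) (κ 2F) (κ 3F) (κ 4F) (κ 5F)

  tabulate₆-≗ : ∀ κ j → tabulate₆ κ j ≡ κ j
  tabulate₆-≗ κ 0F = refl
  tabulate₆-≗ κ 1F = refl
  tabulate₆-≗ κ 2F = refl
  tabulate₆-≗ κ 3F = refl
  tabulate₆-≗ κ 4F = refl
  tabulate₆-≗ κ 5F = refl

  sorted : ∀ κ → sortsAll (tabulate₆ κ) ≡ true
  sorted κ = sorts (κ 0F) (κ 1F) (κ 2F) (κ 3F) (κ 4F) (κ 5F)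

opaque
  layout : ∀ κ → Admissible κ → ∀ e → Layout κ e
  layout κ admissible e =
    arrange (tabulate₆ κ) e ,
    IsLayout-cong (tabulate₆-≗ κ)
      (isLayoutᵇ-sound (tabulate₆ κ) e (arrange (tabulate₆ κ) e)
        (everyColour-sound (λ e → allᵇ (slotOKᵇ (tabulate₆ κ) e (arrange (tabulate₆ κ) e))) all-colours e))
    where
    open LayoutCheck
    all-colours : everyColour (λ e → allᵇ (slotOKᵇ (tabulate₆ κ) e (arrange (tabulate₆ κ) e))) ≡ true
    all-colours =
      [ (λ inadmissible → case trans (sym inadmissible) (cong not (dec-true (admissible? (tabulate₆ κ)) admissible)) of λ ())
      , (λ sorts → sorts) ]′
      (∨-true (not (does (admissible? (tabulate₆ κ))))
              {everyColour (λ e → allᵇ (slotOKᵇ (tabulate₆ κ) e (arrange (tabulate₆ κ) e)))}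
              (trans (sym (sortsAll-≡ (tabulate₆ κ))) (sorted κ)))

xor-identityʳ : ∀ x → x xor false ≡ x
xor-identityʳ false = refl
xor-identityʳ true  = refl

turnSlot : Colour → Bool → Fin 6 → Fin 6
turnSlot w b j = slot (colour j) (side j xor (b ∧ does (colour j ≟ᶜ w)))

colour-turnSlot : ∀ w b j → colour (turnSlot w b j) ≡ colour j
colour-turnSlot w b j = colour-slot (colour j) _

turnSlot-involutive : ∀ w b j → turnSlot w b (turnSlot w b j) ≡ j
turnSlot-involutive w b j
  rewrite colour-slot (colour j) (side j xor (b ∧ does (colour j ≟ᶜ w)))
        | side-slot (colour j) (side j xor (b ∧ does (colour j ≟ᶜ w)))
        | xor-assoc (side j) (b ∧ does (colour j ≟ᶜ w)) (b ∧ does (colour j ≟ᶜ w))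
        | xor-same (b ∧ does (colour j ≟ᶜ w))
        | xor-identityʳ (side j)
        = slot-colour-side j

turnSlot-mate : ∀ w b j → turnSlot w b (mate j) ≡ mate (turnSlot w b j)
turnSlot-mate w b j
  rewrite colour-slot (colour j) (not (side j))
        | side-slot (colour j) (not (side j))
        | colour-slot (colour j) (side j xor (b ∧ does (colour j ≟ᶜ w)))
        | side-slot (colour j) (side j xor (b ∧ does (colour j ≟ᶜ w)))
        = cong (slot (colour j)) (sym (not-distribˡ-xor (side j) _))

turnSlot-away : ∀ w b j → colour j ≢ w → turnSlot w b j ≡ j
turnSlot-away w b j j≢w with colour j ≟ᶜ w
... | yes j≡w = ⊥-elim (j≢w j≡w)
... | no _ rewrite ∧-zeroʳ b | xor-identityʳ (side j) = slot-colour-side j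

turnSlot-first : ∀ w b → turnSlot w b (slot w false) ≡ slot w b
turnSlot-first w b rewrite colour-slot w false | side-slot w false with w ≟ᶜ w
... | yes _  rewrite ∧-identityʳ b = refl
... | no w≢w = ⊥-elim (w≢w refl)

turn : ∀ {κ e} → Layout κ e → Colour → Bool → Layout κ e
turn {κ} {e} (σ , L) w b = τ ∘ₚ σ , record
  { edge-slots = λ j → trans (edge-slots (turnSlot w b j)) (cong (λ c → does (c ≟ᶜ e)) (colour-turnSlot w b j))
  ; paired     = λ j j≢e → trans (cong (λ i → κ (σ ⟨$⟩ʳ i)) (turnSlot-mate w b j))
                                 (paired (turnSlot w b j) (λ τj≡e → j≢e (trans (sym (colour-turnSlot w b j)) τj≡e)))
  }
  where
  open IsLayout L
  τ = permutation (turnSlot w b) (turnSlot w b) (turnSlot-involutive w b) (turnSlot-involutive w b)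

-- Turns the class w exactly when needed for its first slot to have x-side α.
orient : ∀ {κ e} → Layout κ e → Colour → Bool → Layout κ e
orient {κ} L w α = turn L w (xSide (κ (proj₁ L ⟨$⟩ʳ slot w false)) xor α)

orient-away : ∀ {κ e} (L : Layout κ e) w α j → colour j ≢ w → proj₁ (orient L w α) ⟨$⟩ʳ j ≡ proj₁ L ⟨$⟩ʳ j
orient-away L w α j j≢w = cong (proj₁ L ⟨$⟩ʳ_) (turnSlot-away w _ j j≢w)

orient-first : ∀ {κ e} (L : Layout κ e) w α → w ≢ e → xSide (κ (proj₁ (orient L w α) ⟨$⟩ʳ slot w false)) ≡ α
orient-first {κ} (σ , L) w α w≢e
  rewrite turnSlot-first w (xSide (κ (σ ⟨$⟩ʳ slot w false)) xor α)
  with κ (σ ⟨$⟩ʳ slot w false) in first | not-edge-away L w false w≢e | second-slot L w w≢e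
... | sides false β | _ | flipped with α
...   | false = cong xSide first
...   | true  = cong xSide flipped
orient-first {κ} (σ , L) w α w≢e
    | sides true β | _ | flipped with α
...   | true  = cong xSide first
...   | false = cong xSide flipped

-- c and d are the codes of pieces i and i+1 in the same slot; for s = false (true) both
-- y_i^s and x_{i+1}^s would need the vertex a_i (b_i).
Linked : Code → Code → Set
Linked c d = ∀ s → yUses s c ∧ xUses s d ≡ false

Linked-fromEdge : ∀ c d → isEdge c ≡ true → Linked c d
Linked-fromEdge edge d _ s = refl

Linked-toEdge : ∀ c d → isEdge d ≡ true → Linked c d
Linked-toEdge c edge _ s = ∧-zeroʳ (yUses s c)

Linked-opposite : ∀ α β β′ → Linked (sides α β) (sides (not β) β′)
Linked-opposite α false β′ false = refl
Linked-opposite α false β′ true  = refl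
Linked-opposite α true  β′ false = refl
Linked-opposite α true  β′ true  = refl

Linked-pair : ∀ c d → isEdge c ≡ false → isEdge d ≡ false → xSide d ≡ not (ySide c) →
              Linked c d × Linked (compl c) (compl d)
Linked-pair (sides α β) (sides .(not β) β′) _ _ refl =
  Linked-opposite α β β′ , Linked-opposite (not α) (not β) (not β′)

IsThird : Colour → Colour → Colour → Set
IsThird e e′ w = ∀ c → not (does (c ≟ᶜ e)) ∧ not (does (c ≟ᶜ e′)) ≡ does (c ≟ᶜ w)

third-apart : ∀ {e e′ w} → IsThird e e′ w → w ≢ e × w ≢ e′
third-apart {e} {e′} {w} between with w ≟ᶜ e | w ≟ᶜ e′ | between w
... | no w≢e | no w≢e′ | _         = w≢e , w≢e′
... | yes _  | _       | w-between rewrite dec-true (w ≟ᶜ w) refl with () ← w-between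
... | no _   | yes _   | w-between rewrite dec-true (w ≟ᶜ w) refl with () ← w-between

Linked-layouts : ∀ {κ κ′ e e′ σ σ′} → IsLayout κ e σ → IsLayout κ′ e′ σ′ → ∀ w →
                 IsThird e e′ w →
                 xSide (κ′ (σ′ ⟨$⟩ʳ slot w false)) ≡ not (ySide (κ (σ ⟨$⟩ʳ slot w false))) →
                 ∀ j → Linked (κ (σ ⟨$⟩ʳ j)) (κ′ (σ′ ⟨$⟩ʳ j))
Linked-layouts {κ} {κ′} {e} {e′} {σ} {σ′} L L′ w between opposite j
  with colour j ≟ᶜ e | colour j ≟ᶜ e′ | between (colour j)
... | yes j≡e | _ | _ =
  Linked-fromEdge (κ (σ ⟨$⟩ʳ j)) (κ′ (σ′ ⟨$⟩ʳ j))
    (trans (IsLayout.edge-slots L j) (dec-true (colour j ≟ᶜ e) j≡e))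
... | no _ | yes j≡e′ | _ =
  Linked-toEdge (κ (σ ⟨$⟩ʳ j)) (κ′ (σ′ ⟨$⟩ʳ j))
    (trans (IsLayout.edge-slots L′ j) (dec-true (colour j ≟ᶜ e′) j≡e′))
... | no _ | no _ | j-between =
  subst (λ j′ → Linked (κ (σ ⟨$⟩ʳ j′)) (κ′ (σ′ ⟨$⟩ʳ j′)))
        (trans (cong (λ c → slot c (side j)) (sym (does-sound (colour j ≟ᶜ w) (sym j-between)))) (slot-colour-side j))
        (on-slot (side j))
  where
  w≢e  = proj₁ (third-apart between)
  w≢e′ = proj₂ (third-apart between)
  first = Linked-pair (κ (σ ⟨$⟩ʳ slot w false)) (κ′ (σ′ ⟨$⟩ʳ slot w false))
                      (not-edge-away L w false w≢e) (not-edge-away L′ w false w≢e′) opposite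
  on-slot : ∀ s → Linked (κ (σ ⟨$⟩ʳ slot w s)) (κ′ (σ′ ⟨$⟩ʳ slot w s))
  on-slot false = proj₁ first
  on-slot true  = subst₂ Linked (sym (second-slot L w w≢e)) (sym (second-slot L′ w w≢e′)) (proj₂ first)

-- The vertex a_i (s = false) or b_i (s = true) is needed by neither y_i^s nor x_{i+1}^s.
free : Code → Code → Bool → Bool
free c d s = not (yUses s c) ∧ not (xUses s d)

free-exclusive : ∀ c d → Linked c d → isEdge c ∧ isEdge d ≡ false → free c d false ∧ free c d true ≡ false
free-exclusive edge        edge            _      ()
free-exclusive edge        (sides false _) _      _ = refl
free-exclusive edge        (sides true  _) _      _ = refl
free-exclusive (sides _ false) edge        _      _ = refl
free-exclusive (sides _ true)  edge        _      _ = refl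
free-exclusive (sides _ false) (sides false _) linked _ with () ← linked false
free-exclusive (sides _ false) (sides true  _) _      _ = refl
free-exclusive (sides _ true)  (sides false _) _      _ = refl
free-exclusive (sides _ true)  (sides true  _) linked _ with () ← linked true

neither-free : ∀ c d → Linked c d → not (free c d false) ∧ not (free c d true) ≡ not (isEdge c) ∧ not (isEdge d)
neither-free edge            edge            _      = refl
neither-free edge            (sides false _) _      = refl
neither-free edge            (sides true  _) _      = refl
neither-free (sides _ false) edge            _      = refl
neither-free (sides _ true)  edge            _      = refl
neither-free (sides _ false) (sides false _) linked with () ← linked false
neither-free (sides _ false) (sides true  _) _      = refl
neither-free (sides _ true)  (sides false _) _      = refl
neither-free (sides _ true)  (sides true  _) linked with () ← linked true

module _ (G : SGraph) {M : Fin (SGraph.n G) → Fin (SGraph.n G) → Bool}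
         (perfect : PerfectMatching (toGraph G) M) where
  open SGraph G
  open PerfectMatching perfect

  matched-unique : ∀ {v a b} → M v a ≡ true → M v b ≡ true → a ≡ b
  matched-unique {v} {a} {b} va vb = trans (unique a va) (sym (unique b vb))
    where unique = proj₂ (proj₂ (partner v))

  unmatched : ∀ {v a b} → M v a ≡ true → b ≢ a → M v b ≡ false
  unmatched {v} {a} {b} va b≢a with M v b in vb
  ... | false = refl
  ... | true  = ⊥-elim (b≢a (matched-unique vb va))

  matched-among : ∀ {v a b c} → (∀ w → adj v w ≡ true → w ≡ a ⊎ w ≡ b ⊎ w ≡ c) →
                  M v a ≡ true ⊎ M v b ≡ true ⊎ M v c ≡ true
  matched-among {v} neighbours with partner v
  ... | p , vp , _ with neighbours p (edges-M v p vp)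
  ...   | inj₁ refl        = inj₁ vp
  ...   | inj₂ (inj₁ refl) = inj₂ (inj₁ vp)
  ...   | inj₂ (inj₂ refl) = inj₂ (inj₂ vp)

module PieceCodes (Pc : Piece) (cubic : Cubic (Piece.G Pc)) where
  open Piece Pc

  xNbr yNbr : Bool → Fin n
  xNbr false = x0
  xNbr true  = x1
  yNbr false = y0
  yNbr true  = y1

  x-xNbr : ∀ s → adj x (xNbr s) ≡ true
  x-xNbr false = xx0
  x-xNbr true  = xx1

  y-yNbr : ∀ s → adj y (yNbr s) ≡ true
  y-yNbr false = yy0
  y-yNbr true  = yy1

  y≢x : y ≢ x
  y≢x y≡x with () ← trans (sym xy) (trans (cong (adj x) y≡x) (adj-irrefl x))

  xNbr≢x : ∀ s → xNbr s ≢ x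
  xNbr≢x false = x0≢x
  xNbr≢x true  = x1≢x

  xNbr≢y : ∀ s → xNbr s ≢ y
  xNbr≢y false = x0≢y
  xNbr≢y true  = x1≢y

  yNbr≢x : ∀ s → yNbr s ≢ x
  yNbr≢x false = y0≢x
  yNbr≢x true  = y1≢x

  yNbr≢y : ∀ s → yNbr s ≢ y
  yNbr≢y false = y0≢y
  yNbr≢y true  = y1≢y

  xNbr-side : ∀ s → does (xNbr s Fin.≟ x1) ≡ s
  xNbr-side false = dec-false (x0 Fin.≟ x1) x0≢x1
  xNbr-side true  = dec-true (x1 Fin.≟ x1) refl

  yNbr-side : ∀ s → does (yNbr s Fin.≟ y1) ≡ s
  yNbr-side false = dec-false (y0 Fin.≟ y1) y0≢y1
  yNbr-side true  = dec-true (y1 Fin.≟ y1) refl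

  x-neighbours : ∀ w → adj x w ≡ true → w ≡ y ⊎ w ≡ x0 ⊎ w ≡ x1
  x-neighbours = count≡3-exhausted (adj x) (cubic x) xy xx0 xx1 (≢-sym x0≢y) (≢-sym x1≢y) x0≢x1

  y-neighbours : ∀ w → adj y w ≡ true → w ≡ x ⊎ w ≡ y0 ⊎ w ≡ y1
  y-neighbours = count≡3-exhausted (adj y) (cubic y) (trans (adj-sym y x) xy) yy0 yy1 (≢-sym y0≢x) (≢-sym y1≢x) y0≢y1

  codeOf : (Fin n → Fin n → Bool) → Code
  codeOf M = if M x y then edge else sides (M x x1) (M y y1)

  module _ {M} (perfect : PerfectMatching (toGraph G) M) where
    open PerfectMatching perfect

    codeOf-xy : M x y ≡ isEdge (codeOf M)
    codeOf-xy with M x y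
    ... | true  = refl
    ... | false = refl

    codeOf-x : ∀ s → M x (xNbr s) ≡ xUses s (codeOf M)
    codeOf-x s with matched-among G perfect x-neighbours
    codeOf-x false | inj₁ xy∈M rewrite xy∈M = unmatched G perfect xy∈M x0≢y
    codeOf-x true  | inj₁ xy∈M rewrite xy∈M = unmatched G perfect xy∈M x1≢y
    codeOf-x false | inj₂ (inj₁ xx0∈M)
      rewrite unmatched G perfect xx0∈M (≢-sym x0≢y) | unmatched G perfect xx0∈M (≢-sym x0≢x1) = xx0∈M
    codeOf-x true  | inj₂ (inj₁ xx0∈M) rewrite unmatched G perfect xx0∈M (≢-sym x0≢y) = refl
    codeOf-x false | inj₂ (inj₂ xx1∈M)
      rewrite unmatched G perfect xx1∈M (≢-sym x1≢y) | xx1∈M = unmatched G perfect xx1∈M x0≢x1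
    codeOf-x true  | inj₂ (inj₂ xx1∈M) rewrite unmatched G perfect xx1∈M (≢-sym x1≢y) = refl

    codeOf-y : ∀ s → M y (yNbr s) ≡ yUses s (codeOf M)
    codeOf-y s with matched-among G perfect y-neighbours
    codeOf-y false | inj₁ yx∈M rewrite trans (sym-M x y) yx∈M = unmatched G perfect yx∈M y0≢x
    codeOf-y true  | inj₁ yx∈M rewrite trans (sym-M x y) yx∈M = unmatched G perfect yx∈M y1≢x
    codeOf-y false | inj₂ (inj₁ yy0∈M)
      rewrite trans (sym-M x y) (unmatched G perfect yy0∈M (≢-sym y0≢x)) | unmatched G perfect yy0∈M (≢-sym y0≢y1) = yy0∈M
    codeOf-y true  | inj₂ (inj₁ yy0∈M) rewrite trans (sym-M x y) (unmatched G perfect yy0∈M (≢-sym y0≢x)) = refl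
    codeOf-y false | inj₂ (inj₂ yy1∈M)
      rewrite trans (sym-M x y) (unmatched G perfect yy1∈M (≢-sym y1≢x)) | yy1∈M = unmatched G perfect yy1∈M y0≢y1
    codeOf-y true  | inj₂ (inj₂ yy1∈M) rewrite trans (sym-M x y) (unmatched G perfect yy1∈M (≢-sym y1≢x)) = refl

  module _ {M : Fin 6 → Fin n → Fin n → Bool} (perfect : ∀ m → PerfectMatching (toGraph G) (M m))
           (twice : ∀ u v → adj u v ≡ true → count (λ m → M m u v) ≡ 2) where

    codes-admissible : Admissible (λ m → codeOf (M m))
    codes-admissible =
      trans (count-cong (λ m → sym (codeOf-xy (perfect m)))) (twice x y xy) ,
      trans (count-cong (λ m → sym (codeOf-x (perfect m) false))) (twice x x0 xx0) ,
      trans (count-cong (λ m → sym (codeOf-y (perfect m) false))) (twice y y0 yy0)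

-- Colourings of the cycle of pieces and of the tree

parity : ℕ → Colour
parity zero          = c₀
parity (suc zero)    = c₁
parity (suc (suc n)) = parity n

parity-alternates : ∀ n → (parity n ≡ c₀ × parity (suc n) ≡ c₁) ⊎ (parity n ≡ c₁ × parity (suc n) ≡ c₀)
parity-alternates zero          = inj₁ (refl , refl)
parity-alternates (suc zero)    = inj₂ (refl , refl)
parity-alternates (suc (suc n)) = parity-alternates n

parity≢parity-suc : ∀ n → parity n ≢ parity (suc n)
parity≢parity-suc n eq with parity-alternates n
... | inj₁ (p , p′) with () ← trans (sym p) (trans eq p′)
... | inj₂ (p , p′) with () ← trans (sym p) (trans eq p′)

parity≢c₂ : ∀ n → parity n ≢ c₂
parity≢c₂ n eq with parity-alternates n
... | inj₁ (p , _) with () ← trans (sym p) eq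
... | inj₂ (p , _) with () ← trans (sym p) eq

parity-other : ∀ {c} n → c ≢ c₂ → c ≢ parity n → c ≡ parity (suc n)
parity-other {c₂} n c≢c₂ _ = ⊥-elim (c≢c₂ refl)
parity-other {c₀} n _ c≢p with parity-alternates n
... | inj₁ (p , _)  = ⊥-elim (c≢p (sym p))
... | inj₂ (_ , p′) = sym p′
parity-other {c₁} n _ c≢p with parity-alternates n
... | inj₁ (_ , p′) = sym p′
... | inj₂ (p , _)  = ⊥-elim (c≢p (sym p))

-- Piece i uses x_i y_i in the slots of colour cycleColour i.  The vertices c_l and v_m span the
-- cubic tree made of the path c₁ v₀ v₁ … v_t c₀ and the pendant edges c_{m+2} v_m; the path
-- edge v_m v_{m+1} has colour parity m, the end edges c₁ v₀ and v_t c₀ continue the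
-- alternation, and the pendant edges have colour c₂.  leafColour l is the colour at c_l.
module Colouring (t : ℕ) where

  leafColour : Fin (suc (suc (suc t))) → Colour
  leafColour Fin.zero                 = parity t
  leafColour (Fin.suc Fin.zero)       = c₁
  leafColour (Fin.suc (Fin.suc _))    = c₂

  cycleColour : Fin (suc (suc (suc t))) → Colour
  cycleColour Fin.zero              = parity (suc t)
  cycleColour (Fin.suc Fin.zero)    = c₂
  cycleColour (Fin.suc (Fin.suc m)) = parity (toℕ m)

  cycleColour-next : ∀ m → cycleColour (next (Fin.suc (Fin.suc m))) ≡ parity (suc (toℕ m))
  cycleColour-next m with next m | Next-next m
  ... | Fin.zero  | inj₂ (last , _) = cong parity (sym last)
  ... | Fin.suc _ | inj₁ step      = cong parity (sym step)

  cycleColour-proper : ∀ i → cycleColour i ≢ cycleColour (next i)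
  cycleColour-proper Fin.zero              = parity≢c₂ (suc t)
  cycleColour-proper (Fin.suc Fin.zero)    = λ ()
  cycleColour-proper (Fin.suc (Fin.suc m)) rewrite cycleColour-next m = parity≢parity-suc (toℕ m)

  leafColour-third : ∀ i → IsThird (cycleColour i) (cycleColour (next i)) (leafColour i)
  leafColour-third Fin.zero c with parity-alternates t
  ... | inj₁ (p , p′) rewrite p | p′ = by-cases c
    where by-cases : ∀ c → not (does (c ≟ᶜ c₁)) ∧ not (does (c ≟ᶜ c₂)) ≡ does (c ≟ᶜ c₀)
          by-cases c₀ = refl
          by-cases c₁ = refl
          by-cases c₂ = refl
  ... | inj₂ (p , p′) rewrite p | p′ = by-cases c
    where by-cases : ∀ c → not (does (c ≟ᶜ c₀)) ∧ not (does (c ≟ᶜ c₂)) ≡ does (c ≟ᶜ c₁)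
          by-cases c₀ = refl
          by-cases c₁ = refl
          by-cases c₂ = refl
  leafColour-third (Fin.suc Fin.zero) c₀ = refl
  leafColour-third (Fin.suc Fin.zero) c₁ = refl
  leafColour-third (Fin.suc Fin.zero) c₂ = refl
  leafColour-third (Fin.suc (Fin.suc m)) c rewrite cycleColour-next m with parity-alternates (toℕ m)
  ... | inj₁ (p , p′) rewrite p | p′ = by-cases c
    where by-cases : ∀ c → not (does (c ≟ᶜ c₀)) ∧ not (does (c ≟ᶜ c₁)) ≡ does (c ≟ᶜ c₂)
          by-cases c₀ = refl
          by-cases c₁ = refl
          by-cases c₂ = refl
  ... | inj₂ (p , p′) rewrite p | p′ = by-cases c
    where by-cases : ∀ c → not (does (c ≟ᶜ c₁)) ∧ not (does (c ≟ᶜ c₀)) ≡ does (c ≟ᶜ c₂)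
          by-cases c₀ = refl
          by-cases c₁ = refl
          by-cases c₂ = refl

-- Gluing the pieces

module Gluing (t : ℕ) (piece : Fin (suc (suc (suc t))) → Piece) (cubic : ∀ i → Cubic (Piece.G (piece i))) where
  open Colouring t
  open Construction (suc (suc (suc t))) piece
  module H (i : Fin (suc (suc (suc t)))) = PieceCodes (piece i) (cubic i)
  open Piece

  _≟V_ : DecidableEquality ΓV
  hv i u _ _ ≟V hv i′ u′ _ _ with i Fin.≟ i′
  ... | no i≢i′ = no λ { refl → i≢i′ refl }
  ... | yes refl with u Fin.≟ u′
  ...   | yes refl = yes refl
  ...   | no u≢u′  = no λ { refl → u≢u′ refl }
  aV i ≟V aV i′ = map′ (cong aV) (λ { refl → refl }) (i Fin.≟ i′)
  bV i ≟V bV i′ = map′ (cong bV) (λ { refl → refl }) (i Fin.≟ i′)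
  cV i ≟V cV i′ = map′ (cong cV) (λ { refl → refl }) (i Fin.≟ i′)
  vV m ≟V vV m′ = map′ (cong vV) (λ { refl → refl }) (m Fin.≟ m′)
  hv _ _ _ _ ≟V aV _ = no λ ()
  hv _ _ _ _ ≟V bV _ = no λ ()
  hv _ _ _ _ ≟V cV _ = no λ ()
  hv _ _ _ _ ≟V vV _ = no λ ()
  aV _ ≟V hv _ _ _ _ = no λ ()
  aV _ ≟V bV _ = no λ ()
  aV _ ≟V cV _ = no λ ()
  aV _ ≟V vV _ = no λ ()
  bV _ ≟V hv _ _ _ _ = no λ ()
  bV _ ≟V aV _ = no λ ()
  bV _ ≟V cV _ = no λ ()
  bV _ ≟V vV _ = no λ ()
  cV _ ≟V hv _ _ _ _ = no λ ()
  cV _ ≟V aV _ = no λ ()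
  cV _ ≟V bV _ = no λ ()
  cV _ ≟V vV _ = no λ ()
  vV _ ≟V hv _ _ _ _ = no λ ()
  vV _ ≟V aV _ = no λ ()
  vV _ ≟V bV _ = no λ ()
  vV _ ≟V cV _ = no λ ()

  -- The neighbours of v_m on the path towards c₀ and towards c₁; next m wraps to 0 exactly
  -- when m is the last index t.
  up down : Fin (suc t) → ΓV
  up   m = if does (next m Fin.≟ Fin.zero) then cV Fin.zero else vV (next m)
  down m = if does (m Fin.≟ Fin.zero) then cV (Fin.suc Fin.zero) else vV (prev m)

  treeMate : Colour → Fin (suc t) → ΓV
  treeMate c₂ m = cV (Fin.suc (Fin.suc m))
  treeMate c  m = if does (c ≟ᶜ parity (toℕ m)) then up m else down m

  leafNeighbour : Fin (suc (suc (suc t))) → ΓV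
  leafNeighbour Fin.zero              = vV (fromℕ t)
  leafNeighbour (Fin.suc Fin.zero)    = vV Fin.zero
  leafNeighbour (Fin.suc (Fin.suc m)) = vV m

  treeMate-up : ∀ {c} m → c ≢ c₂ → c ≡ parity (toℕ m) → treeMate c m ≡ up m
  treeMate-up {c₂} m c≢c₂ _ = ⊥-elim (c≢c₂ refl)
  treeMate-up {c₀} m _ c≡p rewrite dec-true (c₀ ≟ᶜ parity (toℕ m)) c≡p = refl
  treeMate-up {c₁} m _ c≡p rewrite dec-true (c₁ ≟ᶜ parity (toℕ m)) c≡p = refl

  treeMate-down : ∀ {c} m → c ≢ c₂ → c ≢ parity (toℕ m) → treeMate c m ≡ down m
  treeMate-down {c₂} m c≢c₂ _ = ⊥-elim (c≢c₂ refl)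
  treeMate-down {c₀} m _ c≢p rewrite dec-false (c₀ ≟ᶜ parity (toℕ m)) c≢p = refl
  treeMate-down {c₁} m _ c≢p rewrite dec-false (c₁ ≟ᶜ parity (toℕ m)) c≢p = refl

  up-last : ∀ m → next m ≡ Fin.zero → up m ≡ cV Fin.zero
  up-last m wraps rewrite wraps = refl

  up-step : ∀ m → next m ≢ Fin.zero → up m ≡ vV (next m)
  up-step m nz rewrite dec-false (next m Fin.≟ Fin.zero) nz = refl

  down-step : ∀ m → m ≢ Fin.zero → down m ≡ vV (prev m)
  down-step m nz rewrite dec-false (m Fin.≟ Fin.zero) nz = refl

  up-inversion : ∀ m v → up m ≡ v → (next m ≡ Fin.zero × v ≡ cV Fin.zero) ⊎ (next m ≢ Fin.zero × v ≡ vV (next m))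
  up-inversion m v refl with next m Fin.≟ Fin.zero
  ... | yes wraps = inj₁ (wraps , refl)
  ... | no nz     = inj₂ (nz , refl)

  down-inversion : ∀ m v → down m ≡ v → (m ≡ Fin.zero × v ≡ cV (Fin.suc Fin.zero)) ⊎ (m ≢ Fin.zero × v ≡ vV (prev m))
  down-inversion m v refl with m Fin.≟ Fin.zero
  ... | yes first = inj₁ (first , refl)
  ... | no nz     = inj₂ (nz , refl)

  treeMate-vV : ∀ c m m′ → treeMate c m ≡ vV m′ → treeMate c m′ ≡ vV m
  treeMate-vV c m m′ eq with c ≟ᶜ c₂
  ... | yes refl with () ← eq
  ... | no c≢c₂ with c ≟ᶜ parity (toℕ m)
  ...   | yes c≡p with up-inversion m (vV m′) (trans (sym (treeMate-up m c≢c₂ c≡p)) eq)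
  ...     | inj₂ (nz , refl) = begin
    treeMate c (next m)  ≡⟨ treeMate-down (next m) c≢c₂ (λ c≡p′ → parity≢parity-suc (toℕ m)
                                (trans (sym c≡p) (trans c≡p′ (cong parity (toℕ-next m nz))))) ⟩
    down (next m)        ≡⟨ down-step (next m) nz ⟩
    vV (prev (next m))   ≡⟨ cong vV (prev-next m) ⟩
    vV m                 ∎
  treeMate-vV c m m′ eq | no c≢c₂ | no c≢p with down-inversion m (vV m′) (trans (sym (treeMate-down m c≢c₂ c≢p)) eq)
  ...     | inj₂ (nz , refl) = begin
    treeMate c (prev m)  ≡⟨ treeMate-up (prev m) c≢c₂ (parity-other (suc (toℕ (prev m))) c≢c₂
                                (λ c≡p′ → c≢p (trans c≡p′ (cong parity (sym (toℕ-prev m nz)))))) ⟩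
    up (prev m)          ≡⟨ up-step (prev m) (λ wraps → nz (trans (sym (next-prev m)) wraps)) ⟩
    vV (next (prev m))   ≡⟨ cong vV (next-prev m) ⟩
    vV m                 ∎

  treeMate-cV : ∀ c m l → treeMate c m ≡ cV l → leafColour l ≡ c × leafNeighbour l ≡ vV m
  treeMate-cV c m l eq with c ≟ᶜ c₂
  ... | yes refl with refl ← eq = refl , refl
  ... | no c≢c₂ with c ≟ᶜ parity (toℕ m)
  ...   | yes c≡p with up-inversion m (cV l) (trans (sym (treeMate-up m c≢c₂ c≡p)) eq)
  ...     | inj₁ (wraps , refl) rewrite next≡zero⇒fromℕ m wraps = sym (trans c≡p (cong parity (toℕ-fromℕ t))) , refl
  treeMate-cV c m l eq | no c≢c₂ | no c≢p with down-inversion m (cV l) (trans (sym (treeMate-down m c≢c₂ c≢p)) eq)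
  ...     | inj₁ (refl , refl) = sym (parity-other 0 c≢c₂ c≢p) , refl

  leafNeighbour-treeMate : ∀ l → Σ (Fin (suc t)) λ m → leafNeighbour l ≡ vV m × treeMate (leafColour l) m ≡ cV l
  leafNeighbour-treeMate Fin.zero = fromℕ t , refl ,
    trans (treeMate-up (fromℕ t) (parity≢c₂ t) (cong parity (sym (toℕ-fromℕ t)))) (up-last (fromℕ t) (next-fromℕ t))
  leafNeighbour-treeMate (Fin.suc Fin.zero)    = Fin.zero , refl , refl
  leafNeighbour-treeMate (Fin.suc (Fin.suc m)) = m , refl , refl

  up-adjacent : ∀ m → ΓAdj (vV m) (up m)
  up-adjacent m with up-inversion m (up m) refl | Next-next m
  ... | inj₁ (wraps , eq) | inj₂ (last , _) rewrite eq = inj₂ (c0v Fin.zero m refl last)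
  ... | inj₁ (wraps , eq) | inj₁ step with () ← trans step (cong toℕ wraps)
  ... | inj₂ (nz , eq) | _ rewrite eq = inj₂ (vv m (next m) (toℕ-next m nz))

  down-adjacent : ∀ m → ΓAdj (vV m) (down m)
  down-adjacent m with down-inversion m (down m) refl
  ... | inj₁ (refl , eq) rewrite eq = inj₁ (vc1 Fin.zero (Fin.suc Fin.zero) refl refl)
  ... | inj₂ (nz , eq) rewrite eq = inj₁ (vv (prev m) m (toℕ-prev m nz))

  treeMate-adjacent : ∀ c m → ΓAdj (vV m) (treeMate c m)
  treeMate-adjacent c m with c ≟ᶜ c₂
  ... | yes refl = inj₂ (cv (Fin.suc (Fin.suc m)) m refl)
  ... | no c≢c₂ with c ≟ᶜ parity (toℕ m)
  ...   | yes c≡p = subst (ΓAdj (vV m)) (sym (treeMate-up m c≢c₂ c≡p)) (up-adjacent m)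
  ...   | no c≢p  = subst (ΓAdj (vV m)) (sym (treeMate-down m c≢c₂ c≢p)) (down-adjacent m)

  up≢down : ∀ m → up m ≢ down m
  up≢down m eq with up-inversion m (down m) eq | down-inversion m (down m) refl
  ... | inj₁ (_ , up≡) | inj₁ (_ , down≡) with () ← trans (sym up≡) down≡
  ... | inj₂ (nz , up≡) | inj₂ (nz′ , down≡) =
    m≢1+n+m (toℕ (prev m)) {1} (begin
      toℕ (prev m)             ≡⟨ cong toℕ (vV-injective (trans (sym down≡) up≡)) ⟩
      toℕ (next m)             ≡⟨ toℕ-next m nz ⟩
      suc (toℕ m)              ≡⟨ cong suc (toℕ-prev m nz′) ⟩
      suc (suc (toℕ (prev m))) ∎)
    where
    vV-injective : ∀ {a b} → vV a ≡ vV b → a ≡ b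
    vV-injective refl = refl
  ... | inj₁ (_ , up≡) | inj₂ (_ , down≡) with () ← trans (sym up≡) down≡
  ... | inj₂ (_ , up≡) | inj₁ (_ , down≡) with () ← trans (sym up≡) down≡

  up≢pendant : ∀ m → up m ≢ cV (Fin.suc (Fin.suc m))
  up≢pendant m eq with up-inversion m _ eq
  ... | inj₁ (_ , ())
  ... | inj₂ (_ , ())

  down≢pendant : ∀ m → down m ≢ cV (Fin.suc (Fin.suc m))
  down≢pendant m eq with down-inversion m _ eq
  ... | inj₁ (_ , ())
  ... | inj₂ (_ , ())

  treeMate-injective : ∀ c c′ m → treeMate c m ≡ treeMate c′ m → c ≡ c′
  treeMate-injective c c′ m eq with c ≟ᶜ c₂ | c′ ≟ᶜ c₂
  ... | yes refl | yes refl = refl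
  ... | yes refl | no c′≢c₂ with c′ ≟ᶜ parity (toℕ m)
  ...   | yes c′≡p = ⊥-elim (up≢pendant m (sym (trans eq (treeMate-up m c′≢c₂ c′≡p))))
  ...   | no c′≢p  = ⊥-elim (down≢pendant m (sym (trans eq (treeMate-down m c′≢c₂ c′≢p))))
  treeMate-injective c c′ m eq | no c≢c₂ | yes refl with c ≟ᶜ parity (toℕ m)
  ...   | yes c≡p = ⊥-elim (up≢pendant m (trans (sym (treeMate-up m c≢c₂ c≡p)) eq))
  ...   | no c≢p  = ⊥-elim (down≢pendant m (trans (sym (treeMate-down m c≢c₂ c≢p)) eq))
  treeMate-injective c c′ m eq | no c≢c₂ | no c′≢c₂ with c ≟ᶜ parity (toℕ m) | c′ ≟ᶜ parity (toℕ m)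
  ... | yes c≡p | yes c′≡p = trans c≡p (sym c′≡p)
  ... | no c≢p  | no c′≢p  = trans (parity-other (toℕ m) c≢c₂ c≢p) (sym (parity-other (toℕ m) c′≢c₂ c′≢p))
  ... | yes c≡p | no c′≢p  =
    ⊥-elim (up≢down m (trans (sym (treeMate-up m c≢c₂ c≡p)) (trans eq (treeMate-down m c′≢c₂ c′≢p))))
  ... | no c≢p  | yes c′≡p =
    ⊥-elim (up≢down m (trans (sym (treeMate-up m c′≢c₂ c′≡p)) (trans (sym eq) (treeMate-down m c≢c₂ c≢p))))

  treeMate-tree : ∀ c m → (Σ (Fin (suc t)) λ m′ → treeMate c m ≡ vV m′) ⊎
                          (Σ (Fin (suc (suc (suc t)))) λ l → treeMate c m ≡ cV l)
  treeMate-tree c m with c ≟ᶜ c₂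
  ... | yes refl = inj₂ (_ , refl)
  ... | no c≢c₂ with c ≟ᶜ parity (toℕ m)
  ...   | yes c≡p with up-inversion m (up m) refl
  ...     | inj₁ (_ , up≡) = inj₂ (_ , trans (treeMate-up m c≢c₂ c≡p) up≡)
  ...     | inj₂ (_ , up≡) = inj₁ (_ , trans (treeMate-up m c≢c₂ c≡p) up≡)
  treeMate-tree c m | no c≢c₂ | no c≢p with down-inversion m (down m) refl
  ...     | inj₁ (_ , down≡) = inj₂ (_ , trans (treeMate-down m c≢c₂ c≢p) down≡)
  ...     | inj₂ (_ , down≡) = inj₁ (_ , trans (treeMate-down m c≢c₂ c≢p) down≡)

  ab : Bool → Fin (suc (suc (suc t))) → ΓV
  ab false = aV
  ab true  = bV

  xVertex yVertex : Bool → Fin (suc (suc (suc t))) → ΓV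
  xVertex s i = hv i (H.xNbr i s) (H.xNbr≢x i s) (H.xNbr≢y i s)
  yVertex s i = hv i (H.yNbr i s) (H.yNbr≢x i s) (H.yNbr≢y i s)

  hv-injective : ∀ {i i′ u u′} .{p q p′ q′} → hv i u p q ≡ hv i′ u′ p′ q′ → i ≡ i′
  hv-injective refl = refl

  ab-y-adjacent : ∀ s l → ΓAdj (ab s l) (yVertex s l)
  ab-y-adjacent false l = inj₁ (ay l)
  ab-y-adjacent true  l = inj₁ (by l)

  ab-x-adjacent : ∀ s l → ΓAdj (ab s l) (xVertex s (next l))
  ab-x-adjacent false l = inj₁ (ax l (next l) (Next-next l))
  ab-x-adjacent true  l = inj₁ (bx l (next l) (Next-next l))

  ab-c-adjacent : ∀ s l → ΓAdj (ab s l) (cV l)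
  ab-c-adjacent false l = inj₁ (ac l)
  ab-c-adjacent true  l = inj₁ (bc l)

  leafNeighbour-adjacent : ∀ l → ΓAdj (cV l) (leafNeighbour l)
  leafNeighbour-adjacent l with leafNeighbour-treeMate l
  ... | m , leaf≡ , mate≡ =
    subst (ΓAdj (cV l)) (sym leaf≡) (swap (subst (ΓAdj (vV m)) mate≡ (treeMate-adjacent (leafColour l) m)))

  record Arrangement : Set where
    field
      N       : (i : Fin (suc (suc (suc t)))) → Fin 6 → Fin (n (piece i)) → Fin (n (piece i)) → Bool
      perfect : ∀ i j → PerfectMatching (toGraph (G (piece i))) (N i j)
      twice   : ∀ i u v → adj (piece i) u v ≡ true → count (λ j → N i j u v) ≡ 2
      edge-slots : ∀ i j → isEdge (H.codeOf i (N i j)) ≡ does (colour j ≟ᶜ cycleColour i)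
      linked  : ∀ i j → Linked (H.codeOf i (N i j)) (H.codeOf (next i) (N (next i) j))

  module Glued (A : Arrangement) where
    open Arrangement A

    κ : Fin (suc (suc (suc t))) → Fin 6 → Code
    κ i j = H.codeOf i (N i j)

    partnerIn : ∀ i → Fin 6 → Fin (n (piece i)) → Fin (n (piece i))
    partnerIn i j u = proj₁ (PerfectMatching.partner (perfect i j) u)

    partnerIn-matched : ∀ i j u → N i j u (partnerIn i j u) ≡ true
    partnerIn-matched i j u = proj₁ (proj₂ (PerfectMatching.partner (perfect i j) u))

    partnerIn-unique : ∀ i j u w → N i j u w ≡ true → partnerIn i j u ≡ w
    partnerIn-unique i j u w uw = sym (proj₂ (proj₂ (PerfectMatching.partner (perfect i j) u)) w uw)

    -- A vertex of H_i matched to x_i or y_i in G_i is matched in Γ to the vertex a or b that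
    -- replaces x_i, y_i on the edge towards it.
    innerMate : ∀ i → Fin 6 → Fin (n (piece i)) → ΓV
    innerMate i j u with partnerIn i j u Fin.≟ x (piece i) | partnerIn i j u Fin.≟ y (piece i)
    ... | yes _   | _       = ab (does (u Fin.≟ x1 (piece i))) (prev i)
    ... | no _    | yes _   = ab (does (u Fin.≟ y1 (piece i))) i
    ... | no p≢x  | no p≢y  = hv i (partnerIn i j u) p≢x p≢y

    innerMate-x : ∀ i j s → xUses s (κ i j) ≡ true → innerMate i j (H.xNbr i s) ≡ ab s (prev i)
    innerMate-x i j s uses with partnerIn i j (H.xNbr i s) Fin.≟ x (piece i)
    ... | yes _ = cong (λ b → ab b (prev i)) (H.xNbr-side i s)
    ... | no p≢x = ⊥-elim (p≢x (partnerIn-unique i j _ _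
          (trans (PerfectMatching.sym-M (perfect i j) _ _) (trans (H.codeOf-x i (perfect i j) s) uses))))

    innerMate-y : ∀ i j s → yUses s (κ i j) ≡ true → innerMate i j (H.yNbr i s) ≡ ab s i
    innerMate-y i j s uses
      with partnerIn i j (H.yNbr i s) Fin.≟ x (piece i) | partnerIn i j (H.yNbr i s) Fin.≟ y (piece i)
    ... | yes p≡x | _ = ⊥-elim (H.y≢x i (trans (sym p≡y) p≡x))
      where
      p≡y = partnerIn-unique i j _ _
              (trans (PerfectMatching.sym-M (perfect i j) _ _) (trans (H.codeOf-y i (perfect i j) s) uses))
    ... | no _ | yes _ = cong (λ b → ab b i) (H.yNbr-side i s)
    ... | no _ | no p≢y = ⊥-elim (p≢y (partnerIn-unique i j _ _
          (trans (PerfectMatching.sym-M (perfect i j) _ _) (trans (H.codeOf-y i (perfect i j) s) uses))))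

    innerMate-inner : ∀ i j u w .(pw : w ≢ x (piece i)) .(qw : w ≢ y (piece i)) →
                      N i j u w ≡ true → innerMate i j u ≡ hv i w pw qw
    innerMate-inner i j u w pw qw uw
      with partnerIn i j u Fin.≟ x (piece i) | partnerIn i j u Fin.≟ y (piece i) | partnerIn-unique i j u w uw
    ... | yes p≡x | _ | p≡w = ⊥-elim-irr (pw (trans (sym p≡w) p≡x))
    ... | no _ | yes p≡y | p≡w = ⊥-elim-irr (qw (trans (sym p≡w) p≡y))
    ... | no _ | no _ | refl = refl

    data InnerView (i : Fin (suc (suc (suc t)))) (j : Fin 6) (u : Fin (n (piece i))) : Set where
      via-x : ∀ s → u ≡ H.xNbr i s → xUses s (κ i j) ≡ true → InnerView i j u
      via-y : ∀ s → u ≡ H.yNbr i s → yUses s (κ i j) ≡ true → InnerView i j u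
      inner : ∀ w (pw : w ≢ x (piece i)) (qw : w ≢ y (piece i)) → N i j u w ≡ true → InnerView i j u

    matched-to : ∀ i j u {v} → partnerIn i j u ≡ v → N i j v u ≡ true
    matched-to i j u {v} p≡v =
      trans (PerfectMatching.sym-M (perfect i j) v u) (subst (λ w → N i j u w ≡ true) p≡v (partnerIn-matched i j u))

    x-uses : ∀ i j s {u} → u ≡ H.xNbr i s → N i j (x (piece i)) u ≡ true → xUses s (κ i j) ≡ true
    x-uses i j s u≡ xu = trans (sym (H.codeOf-x i (perfect i j) s)) (subst (λ w → N i j (x (piece i)) w ≡ true) u≡ xu)

    y-uses : ∀ i j s {u} → u ≡ H.yNbr i s → N i j (y (piece i)) u ≡ true → yUses s (κ i j) ≡ true
    y-uses i j s u≡ yu = trans (sym (H.codeOf-y i (perfect i j) s)) (subst (λ w → N i j (y (piece i)) w ≡ true) u≡ yu)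

    innerView : ∀ i j u → u ≢ x (piece i) → u ≢ y (piece i) → InnerView i j u
    innerView i j u u≢x u≢y with partnerIn i j u Fin.≟ x (piece i) | partnerIn i j u Fin.≟ y (piece i)
    ... | yes p≡x | _ with H.x-neighbours i u (PerfectMatching.edges-M (perfect i j) _ _ (matched-to i j u p≡x))
    ...   | inj₁ u≡y         = ⊥-elim (u≢y u≡y)
    ...   | inj₂ (inj₁ u≡x0) = via-x false u≡x0 (x-uses i j false u≡x0 (matched-to i j u p≡x))
    ...   | inj₂ (inj₂ u≡x1) = via-x true  u≡x1 (x-uses i j true  u≡x1 (matched-to i j u p≡x))
    innerView i j u u≢x u≢y | no _ | yes p≡y
      with H.y-neighbours i u (PerfectMatching.edges-M (perfect i j) _ _ (matched-to i j u p≡y))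
    ...   | inj₁ u≡x         = ⊥-elim (u≢x u≡x)
    ...   | inj₂ (inj₁ u≡y0) = via-y false u≡y0 (y-uses i j false u≡y0 (matched-to i j u p≡y))
    ...   | inj₂ (inj₂ u≡y1) = via-y true  u≡y1 (y-uses i j true  u≡y1 (matched-to i j u p≡y))
    innerView i j u u≢x u≢y | no p≢x | no p≢y = inner (partnerIn i j u) p≢x p≢y (partnerIn-matched i j u)

    freeAt : Fin 6 → Bool → Fin (suc (suc (suc t))) → Bool
    freeAt j s l = free (κ l j) (κ (next l) j) s

    abMate : Fin 6 → Bool → Fin (suc (suc (suc t))) → ΓV
    abMate j s l = if yUses s (κ l j) then yVertex s l else if xUses s (κ (next l) j) then xVertex s (next l) else cV l

    cMate : Fin 6 → Fin (suc (suc (suc t))) → ΓV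
    cMate j l = if freeAt j false l then aV l else if freeAt j true l then bV l else leafNeighbour l

    π : Fin 6 → ΓV → ΓV
    π j (hv i u _ _) = innerMate i j u
    π j (aV l)       = abMate j false l
    π j (bV l)       = abMate j true l
    π j (cV l)       = cMate j l
    π j (vV m)       = treeMate (colour j) m

    π-ab : ∀ j s l → π j (ab s l) ≡ abMate j s l
    π-ab j false l = refl
    π-ab j true  l = refl

    not-both-edge : ∀ l j → isEdge (κ l j) ∧ isEdge (κ (next l) j) ≡ false
    not-both-edge l j rewrite edge-slots l j | edge-slots (next l) j with colour j ≟ᶜ cycleColour l
    ... | no _    = refl
    ... | yes j≡l = dec-false (colour j ≟ᶜ cycleColour (next l)) (λ j≡l′ → cycleColour-proper l (trans (sym j≡l) j≡l′))

    free-disjoint : ∀ j l → freeAt j false l ∧ freeAt j true l ≡ false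
    free-disjoint j l = free-exclusive (κ l j) (κ (next l) j) (linked l j) (not-both-edge l j)

    unfree-leaf : ∀ j l → not (freeAt j false l) ∧ not (freeAt j true l) ≡ does (colour j ≟ᶜ leafColour l)
    unfree-leaf j l = begin
      not (freeAt j false l) ∧ not (freeAt j true l)
        ≡⟨ neither-free (κ l j) (κ (next l) j) (linked l j) ⟩
      not (isEdge (κ l j)) ∧ not (isEdge (κ (next l) j))
        ≡⟨ cong₂ (λ a b → not a ∧ not b) (edge-slots l j) (edge-slots (next l) j) ⟩
      not (does (colour j ≟ᶜ cycleColour l)) ∧ not (does (colour j ≟ᶜ cycleColour (next l)))
        ≡⟨ leafColour-third l (colour j) ⟩
      does (colour j ≟ᶜ leafColour l) ∎

    abMate-y : ∀ j s l → yUses s (κ l j) ≡ true → abMate j s l ≡ yVertex s l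
    abMate-y j s l ys rewrite ys = refl

    abMate-x : ∀ j s l → xUses s (κ (next l) j) ≡ true → abMate j s l ≡ xVertex s (next l)
    abMate-x j s l xs with yUses s (κ l j) | linked l j s
    ... | false | _   rewrite xs = refl
    ... | true  | y∧x rewrite xs with () ← y∧x

    abMate-c : ∀ j s l → freeAt j s l ≡ true → abMate j s l ≡ cV l
    abMate-c j s l fr with yUses s (κ l j) | xUses s (κ (next l) j)
    ... | false | false = refl

    abView : ∀ j s l → yUses s (κ l j) ≡ true ⊎ xUses s (κ (next l) j) ≡ true ⊎ freeAt j s l ≡ true
    abView j s l with yUses s (κ l j) | xUses s (κ (next l) j)
    ... | true  | _     = inj₁ refl
    ... | false | true  = inj₂ (inj₁ refl)
    ... | false | false = inj₂ (inj₂ refl)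

    cMate-free : ∀ j s l → freeAt j s l ≡ true → cMate j l ≡ ab s l
    cMate-free j false l fr rewrite fr = refl
    cMate-free j true  l fr with freeAt j false l | free-disjoint j l
    ... | false | _    rewrite fr = refl
    ... | true  | both rewrite fr with () ← both

    cMate-leaf : ∀ j l → colour j ≡ leafColour l → cMate j l ≡ leafNeighbour l
    cMate-leaf j l j≡l with freeAt j false l | freeAt j true l | unfree-leaf j l
    ... | false | false | _ = refl
    ... | true  | _     | unfree rewrite dec-true (colour j ≟ᶜ leafColour l) j≡l with () ← unfree
    ... | false | true  | unfree rewrite dec-true (colour j ≟ᶜ leafColour l) j≡l with () ← unfree

    cView : ∀ j l → freeAt j false l ≡ true ⊎ freeAt j true l ≡ true ⊎ colour j ≡ leafColour l
    cView j l with freeAt j false l | freeAt j true l | unfree-leaf j l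
    ... | true  | _     | _ = inj₁ refl
    ... | false | true  | _ = inj₂ (inj₁ refl)
    ... | false | false | leaf = inj₂ (inj₂ (does-sound (colour j ≟ᶜ leafColour l) (sym leaf)))

    abMate-x-prev : ∀ j s i → xUses s (κ i j) ≡ true → abMate j s (prev i) ≡ xVertex s i
    abMate-x-prev j s i xs =
      trans (abMate-x j s (prev i) (subst (λ i′ → xUses s (κ i′ j) ≡ true) (sym (next-prev i)) xs))
            (cong (xVertex s) (next-prev i))

    π-abMate : ∀ j s l → π j (abMate j s l) ≡ ab s l
    π-abMate j s l with abView j s l
    ... | inj₁ ys = trans (cong (π j) (abMate-y j s l ys)) (innerMate-y l j s ys)
    ... | inj₂ (inj₁ xs) = begin
      π j (abMate j s l)              ≡⟨ cong (π j) (abMate-x j s l xs) ⟩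
      innerMate (next l) j (H.xNbr (next l) s) ≡⟨ innerMate-x (next l) j s xs ⟩
      ab s (prev (next l))            ≡⟨ cong (ab s) (prev-next l) ⟩
      ab s l                          ∎
    ... | inj₂ (inj₂ fr) = trans (cong (π j) (abMate-c j s l fr)) (cMate-free j s l fr)

    π-involutive : ∀ j v → π j (π j v) ≡ v
    π-involutive j (hv i u pu qu) with innerView i j u (λ e → ⊥-elim-irr (pu e)) (λ e → ⊥-elim-irr (qu e))
    ... | via-x s refl xs = begin
      π j (innerMate i j (H.xNbr i s)) ≡⟨ cong (π j) (innerMate-x i j s xs) ⟩
      π j (ab s (prev i))           ≡⟨ π-ab j s (prev i) ⟩
      abMate j s (prev i)           ≡⟨ abMate-x-prev j s i xs ⟩
      xVertex s i                   ∎
    ... | via-y s refl ys = trans (cong (π j) (innerMate-y i j s ys)) (trans (π-ab j s i) (abMate-y j s i ys))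
    ... | inner w pw qw uw =
      trans (cong (π j) (innerMate-inner i j u w pw qw uw))
            (innerMate-inner i j w u pu qu (trans (PerfectMatching.sym-M (perfect i j) w u) uw))
    π-involutive j (aV l) = π-abMate j false l
    π-involutive j (bV l) = π-abMate j true l
    π-involutive j (cV l) with cView j l
    ... | inj₁ fr = trans (cong (π j) (cMate-free j false l fr)) (abMate-c j false l fr)
    ... | inj₂ (inj₁ fr) = trans (cong (π j) (cMate-free j true l fr)) (abMate-c j true l fr)
    ... | inj₂ (inj₂ j≡l) with leafNeighbour-treeMate l
    ...   | m , leaf≡ , mate≡ = begin
      π j (cMate j l)            ≡⟨ cong (π j) (trans (cMate-leaf j l j≡l) leaf≡) ⟩
      treeMate (colour j) m         ≡⟨ cong (λ c → treeMate c m) j≡l ⟩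
      treeMate (leafColour l) m     ≡⟨ mate≡ ⟩
      cV l                       ∎
    π-involutive j (vV m) with treeMate-tree (colour j) m
    ... | inj₁ (m′ , mate≡) = trans (cong (π j) mate≡) (treeMate-vV (colour j) m m′ mate≡)
    ... | inj₂ (l , mate≡) with treeMate-cV (colour j) m l mate≡
    ...   | l≡j , leaf≡ = trans (cong (π j) mate≡) (trans (cMate-leaf j l (sym l≡j)) leaf≡)

    abMate-adjacent : ∀ j s l → ΓAdj (ab s l) (abMate j s l)
    abMate-adjacent j s l with abView j s l
    ... | inj₁ ys        = subst (ΓAdj (ab s l)) (sym (abMate-y j s l ys)) (ab-y-adjacent s l)
    ... | inj₂ (inj₁ xs) = subst (ΓAdj (ab s l)) (sym (abMate-x j s l xs)) (ab-x-adjacent s l)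
    ... | inj₂ (inj₂ fr) = subst (ΓAdj (ab s l)) (sym (abMate-c j s l fr)) (ab-c-adjacent s l)

    π-adjacent : ∀ j v → ΓAdj v (π j v)
    π-adjacent j (hv i u pu qu) with innerView i j u (λ e → ⊥-elim-irr (pu e)) (λ e → ⊥-elim-irr (qu e))
    ... | via-x s refl xs = subst (ΓAdj (xVertex s i)) (sym (innerMate-x i j s xs))
                              (swap (subst (λ i′ → ΓAdj (ab s (prev i)) (xVertex s i′)) (next-prev i) (ab-x-adjacent s (prev i))))
    ... | via-y s refl ys = subst (ΓAdj (yVertex s i)) (sym (innerMate-y i j s ys)) (swap (ab-y-adjacent s i))
    ... | inner w pw qw uw = subst (ΓAdj (hv i u pu qu)) (sym (innerMate-inner i j u w pw qw uw))
                               (inj₁ (hh i u w pu qu pw qw (PerfectMatching.edges-M (perfect i j) u w uw)))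
    π-adjacent j (aV l) = abMate-adjacent j false l
    π-adjacent j (bV l) = abMate-adjacent j true l
    π-adjacent j (cV l) with cView j l
    ... | inj₁ fr        = subst (ΓAdj (cV l)) (sym (cMate-free j false l fr)) (swap (ab-c-adjacent false l))
    ... | inj₂ (inj₁ fr) = subst (ΓAdj (cV l)) (sym (cMate-free j true l fr)) (swap (ab-c-adjacent true l))
    ... | inj₂ (inj₂ j≡l) = subst (ΓAdj (cV l)) (sym (cMate-leaf j l j≡l)) (leafNeighbour-adjacent l)
    π-adjacent j (vV m) = treeMate-adjacent (colour j) m

    matching : Fin 6 → ΓV → ΓV → Bool
    matching j = matchingOf Γ _≟V_ (π j)

    matching-perfect : ∀ j → PerfectMatching Γ (matching j)
    matching-perfect j = involution-perfectMatching Γ _≟V_ (π j) (π-involutive j) (π-adjacent j)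

    ab≢hv : ∀ s l {i w} .{p q} → ab s l ≢ hv i w p q
    ab≢hv false l ()
    ab≢hv true  l ()

    hv-point-injective : ∀ {i u u′} .{p q p′ q′} → hv i u p q ≡ hv i u′ p′ q′ → u ≡ u′
    hv-point-injective refl = refl

    innerMate-matching : ∀ i j u w .pu .qu .pw .qw → matching j (hv i u pu qu) (hv i w pw qw) ≡ N i j u w
    innerMate-matching i j u w pu qu pw qw = does-≡ (innerMate i j u ≟V hv i w pw qw) (N i j u w) to (innerMate-inner i j u w pw qw)
      where
      to : innerMate i j u ≡ hv i w pw qw → N i j u w ≡ true
      to mate≡ with innerView i j u (λ e → ⊥-elim-irr (pu e)) (λ e → ⊥-elim-irr (qu e))
      ... | via-x s refl xs = ⊥-elim (ab≢hv s (prev i) (trans (sym (innerMate-x i j s xs)) mate≡))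
      ... | via-y s refl ys = ⊥-elim (ab≢hv s i (trans (sym (innerMate-y i j s ys)) mate≡))
      ... | inner w′ pw′ qw′ uw′ =
        subst (λ v → N i j u v ≡ true)
              (hv-point-injective (trans (sym (innerMate-inner i j u w′ pw′ qw′ uw′)) mate≡)) uw′

    abMate-y-matching : ∀ j s l → matching j (ab s l) (yVertex s l) ≡ yUses s (κ l j)
    abMate-y-matching j s l = does-≡ (π j (ab s l) ≟V yVertex s l) _ to (λ ys → trans (π-ab j s l) (abMate-y j s l ys))
      where
      to : π j (ab s l) ≡ yVertex s l → yUses s (κ l j) ≡ true
      to mate≡ with abView j s l
      ... | inj₁ ys        = ys
      ... | inj₂ (inj₁ xs) =
        ⊥-elim (next≢id l (hv-injective (trans (sym (abMate-x j s l xs)) (trans (sym (π-ab j s l)) mate≡))))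
      ... | inj₂ (inj₂ fr) with () ← trans (sym (abMate-c j s l fr)) (trans (sym (π-ab j s l)) mate≡)

    abMate-x-matching : ∀ j s l → matching j (ab s l) (xVertex s (next l)) ≡ xUses s (κ (next l) j)
    abMate-x-matching j s l = does-≡ (π j (ab s l) ≟V xVertex s (next l)) _ to (λ xs → trans (π-ab j s l) (abMate-x j s l xs))
      where
      to : π j (ab s l) ≡ xVertex s (next l) → xUses s (κ (next l) j) ≡ true
      to mate≡ with abView j s l
      ... | inj₁ ys        =
        ⊥-elim (next≢id l (sym (hv-injective (trans (sym (abMate-y j s l ys)) (trans (sym (π-ab j s l)) mate≡)))))
      ... | inj₂ (inj₁ xs) = xs
      ... | inj₂ (inj₂ fr) with () ← trans (sym (abMate-c j s l fr)) (trans (sym (π-ab j s l)) mate≡)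

    abMate-c-matching : ∀ j s l → matching j (ab s l) (cV l) ≡ freeAt j s l
    abMate-c-matching j s l = does-≡ (π j (ab s l) ≟V cV l) _ to (λ fr → trans (π-ab j s l) (abMate-c j s l fr))
      where
      to : π j (ab s l) ≡ cV l → freeAt j s l ≡ true
      to mate≡ with abView j s l
      ... | inj₁ ys        with () ← trans (sym (abMate-y j s l ys)) (trans (sym (π-ab j s l)) mate≡)
      ... | inj₂ (inj₁ xs) with () ← trans (sym (abMate-x j s l xs)) (trans (sym (π-ab j s l)) mate≡)
      ... | inj₂ (inj₂ fr) = fr

    y-twice : ∀ s l → count (λ j → yUses s (κ l j)) ≡ 2
    y-twice s l = trans (count-cong (λ j → sym (H.codeOf-y l (perfect l j) s))) (twice l _ _ (H.y-yNbr l s))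

    x-twice : ∀ s l → count (λ j → xUses s (κ l j)) ≡ 2
    x-twice s l = trans (count-cong (λ j → sym (H.codeOf-x l (perfect l j) s))) (twice l _ _ (H.x-xNbr l s))

    free-twice : ∀ s l → count (λ j → freeAt j s l) ≡ 2
    free-twice s l with count-partition (λ j → yUses s (κ l j)) (λ j → xUses s (κ (next l) j)) (λ j → linked l j s)
    ... | total rewrite y-twice s l | x-twice s (next l) = +-cancelˡ-≡ 4 _ _ total

    tree-twice : ∀ c m → count (λ j → matching j (vV m) (treeMate c m)) ≡ 2
    tree-twice c m = trans (count-cong same-colour) (count-colour c)
      where
      same-colour : ∀ j → matching j (vV m) (treeMate c m) ≡ does (colour j ≟ᶜ c)
      same-colour j = does-⇔ (mk⇔ (treeMate-injective (colour j) c m) (cong (λ c′ → treeMate c′ m)))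
                             (treeMate (colour j) m ≟V treeMate c m) (colour j ≟ᶜ c)

    leaf-twice : ∀ l m → leafNeighbour l ≡ vV m → count (λ j → matching j (vV m) (cV l)) ≡ 2
    leaf-twice l m leaf≡ with leafNeighbour-treeMate l
    ... | m′ , leaf≡′ , mate≡ with trans (sym leaf≡) leaf≡′
    ...   | refl = subst (λ v → count (λ j → matching j (vV m) v) ≡ 2) mate≡ (tree-twice (leafColour l) m)

    matching-sym : ∀ j u v → matching j u v ≡ matching j v u
    matching-sym j = PerfectMatching.sym-M (matching-perfect j)

    count-flip : ∀ u v → count (λ j → matching j v u) ≡ 2 → count (λ j → matching j u v) ≡ 2
    count-flip u v twice′ = trans (count-cong (λ j → matching-sym j u v)) twice′

    arc-twice : ∀ u v → Arc u v → count (λ j → matching j u v) ≡ 2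
    arc-twice _ _ (hh i u w pu qu pw qw uw) = trans (count-cong (λ j → innerMate-matching i j u w pu qu pw qw)) (twice i u w uw)
    arc-twice _ _ (ac l) = trans (count-cong (λ j → abMate-c-matching j false l)) (free-twice false l)
    arc-twice _ _ (bc l) = trans (count-cong (λ j → abMate-c-matching j true l)) (free-twice true l)
    arc-twice _ _ (ay l) = trans (count-cong (λ j → abMate-y-matching j false l)) (y-twice false l)
    arc-twice _ _ (by l) = trans (count-cong (λ j → abMate-y-matching j true l)) (y-twice true l)
    arc-twice _ _ (ax l l′ l→l′) with Next⇒next l→l′
    ... | refl = trans (count-cong (λ j → abMate-x-matching j false l)) (x-twice false (next l))
    arc-twice _ _ (bx l l′ l→l′) with Next⇒next l→l′
    ... | refl = trans (count-cong (λ j → abMate-x-matching j true l)) (x-twice true (next l))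
    arc-twice _ _ (c0v i m i≡0 m≡t)
      with toℕ-injective {i = i} {j = Fin.zero} i≡0
         | toℕ-injective {i = m} {j = fromℕ t} (trans (suc-injective m≡t) (sym (toℕ-fromℕ t)))
    ... | refl | refl = count-flip (cV Fin.zero) (vV (fromℕ t)) (leaf-twice Fin.zero (fromℕ t) refl)
    arc-twice _ _ (vv m m′ m′≡) with Next⇒next {i = m} (inj₁ (sym m′≡))
    ... | refl = count-flip (vV (next m)) (vV m)
                   (subst (λ v → count (λ j → matching j (vV m) v) ≡ 2) up≡ (tree-twice (parity (toℕ m)) m))
      where
      up≡ : treeMate (parity (toℕ m)) m ≡ vV (next m)
      up≡ = trans (treeMate-up m (parity≢c₂ (toℕ m)) refl)
                  (up-step m (λ wraps → 0≢1+n (trans (cong toℕ (sym wraps)) m′≡)))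
    arc-twice _ _ (vc1 m i m≡0 i≡1)
      with toℕ-injective {i = m} {j = Fin.zero} m≡0 | toℕ-injective {i = i} {j = Fin.suc Fin.zero} i≡1
    ... | refl | refl = leaf-twice (Fin.suc Fin.zero) Fin.zero refl
    arc-twice _ _ (cv i m i≡) with toℕ-injective {i = i} {j = Fin.suc (Fin.suc m)} i≡
    ... | refl = count-flip (cV (Fin.suc (Fin.suc m))) (vV m) (leaf-twice (Fin.suc (Fin.suc m)) m refl)

    cover : HasFulkersonCover Γ
    cover = matching , matching-perfect , adjacent-twice
      where
      adjacent-twice : ∀ u v → ΓAdj u v → count (λ j → matching j u v) ≡ 2
      adjacent-twice u v (inj₁ u→v) = arc-twice u v u→v
      adjacent-twice u v (inj₂ v→u) = count-flip u v (arc-twice v u v→u)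

  module _ (covers : ∀ i → HasFulkersonCover (toGraph (G (piece i)))) where

    private
      M : ∀ i → Fin 6 → Fin (n (piece i)) → Fin (n (piece i)) → Bool
      M i = proj₁ (covers i)

      M-perfect : ∀ i m → PerfectMatching (toGraph (G (piece i))) (M i m)
      M-perfect i = proj₁ (proj₂ (covers i))

      M-twice : ∀ i u v → adj (piece i) u v ≡ true → count (λ m → M i m u v) ≡ 2
      M-twice i = proj₂ (proj₂ (covers i))

      codes : ∀ i → Fin 6 → Code
      codes i m = H.codeOf i (M i m)

      base : ∀ i → Layout (codes i) (cycleColour i)
      base i = layout (codes i) (H.codes-admissible i (M-perfect i) (M-twice i)) (cycleColour i)

      oriented : ∀ i → Bool → Layout (codes i) (cycleColour i)
      oriented i α = orient (base i) (leafColour (prev i)) α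

      -- The x-side that piece i+1 has to show in the first slot of class leafColour i when
      -- piece i is oriented by α.
      demanded : ∀ i → Bool → Bool
      demanded i α = not (ySide (codes i (proj₁ (oriented i α) ⟨$⟩ʳ slot (leafColour i) false)))

      -- Piece 0 is oriented in class leafColour (k-1) = c₂, which is not the class leafColour 0
      -- it shares with piece 1: this is what makes the orientations consistent around the cycle.
      demanded-constant : ∀ α α′ → demanded Fin.zero α ≡ demanded Fin.zero α′
      demanded-constant α α′ = cong (λ m → not (ySide (codes Fin.zero m)))
        (trans (orient-away (base Fin.zero) _ α (slot (leafColour Fin.zero) false) away)
               (sym (orient-away (base Fin.zero) _ α′ (slot (leafColour Fin.zero) false) away)))
        where
        away : colour (slot (leafColour Fin.zero) false) ≢ leafColour (prev Fin.zero)
        away eq = parity≢c₂ t (trans (sym (colour-slot (leafColour Fin.zero) false)) eq)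

      α : Fin (suc (suc (suc t))) → Bool
      α = proj₁ (cyclic-recurrence demanded demanded-constant)

      σ : ∀ i → Permutation′ 6
      σ i = proj₁ (oriented i (α i))

    arrangement : Arrangement
    arrangement = record
      { N       = λ i j → M i (σ i ⟨$⟩ʳ j)
      ; perfect = λ i j → M-perfect i (σ i ⟨$⟩ʳ j)
      ; twice   = λ i u v uv → trans (count-permute (λ m → M i m u v) (σ i)) (M-twice i u v uv)
      ; edge-slots = λ i → IsLayout.edge-slots (proj₂ (oriented i (α i)))
      ; linked  = linked
      }
      where
      κ : ∀ i → Fin 6 → Code
      κ i j = codes i (σ i ⟨$⟩ʳ j)

      first-sides : ∀ i → xSide (κ (next i) (slot (leafColour i) false)) ≡ not (ySide (κ i (slot (leafColour i) false)))
      first-sides i = begin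
        xSide (κ (next i) (slot (leafColour i) false))
          ≡⟨ cong (λ l → xSide (κ (next i) (slot (leafColour l) false))) (sym (prev-next i)) ⟩
        xSide (κ (next i) (slot (leafColour (prev (next i))) false))
          ≡⟨ orient-first (base (next i)) (leafColour (prev (next i))) (α (next i))
               (subst (λ l → leafColour l ≢ cycleColour (next i)) (sym (prev-next i))
                      (proj₂ (third-apart (leafColour-third i)))) ⟩
        α (next i)
          ≡⟨ proj₂ (cyclic-recurrence demanded demanded-constant) i ⟩
        not (ySide (κ i (slot (leafColour i) false))) ∎

      linked : ∀ i j → Linked (κ i j) (κ (next i) j)
      linked i = Linked-layouts (proj₂ (oriented i (α i))) (proj₂ (oriented (next i) (α (next i))))
                                (leafColour i) (leafColour-third i) (first-sides i)

theorem1p1 : (k : ℕ) → 2 < k → (P : Fin k → Piece) →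
    (∀ i → Cubic (Piece.G (P i))) →
    (∀ i → Bridgeless (Piece.G (P i))) →
    (∀ i → Cyclically4EdgeConnected (Piece.G (P i))) →
    (∀ i → HasFulkersonCover (toGraph (Piece.G (P i)))) →
    HasFulkersonCover (Construction.Γ k P)
theorem1p1 (suc (suc (suc t))) _ P cubic _ _ covers = Glued.cover (arrangement covers)
  where open Gluing t P cubic
theorem1p1 (suc zero) (s≤s ())
theorem1p1 (suc (suc zero)) (s≤s (s≤s ()))
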